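{- Let $k\ge 2$, $p,t,m\in\mathbb{N}$ and $n=pt$. Let $G_0^*$ be a $k$-uniform hypergraph with vertex set $V_0$, $|V_0|=n$, and let $P=\{U_1,\dots,U_t\}$ be a partition of $V_0$ with $|U_i|=p$ for all $i$. Order $V_0$ so that the vertices of $U_1$ come first, then those of $U_2$, and so on, and let $A(G_0^*)$ be the adjacency matrix with respect to this order. For $i=1,\dots,t$ let $G_i^*$ be a $(k,r)$-regular hypergraph of order $m$ (the same $r$ and $m$ for all $i$), and let $G^*=G_0^*\odot_p^t G_i^*$ be the generalized corona. Put $$a=\begin{cases} p\Bigl(\binom{p+m-2}{k-2}-\binom{p-2}{k-2}\Bigr) & \text{if } 2\le p\le n,\\ 0 & \text{if } p=1,\end{cases}\qquad b=\binom{p+m-2}{k-2},\qquad c=\binom{p+m-2}{k-2}-\binom{m-2}{k-2},$$ and $Y_i=A(G_i^*)+c(J_m-I_m)$. Then for every real $\lambda\neq r(k-1)+c(m-1)$, $$P_{A(G^*)}(\lambda)=\Bigl(\prod_{i=1}^t \det(Y_i-\lambda I_m)\Bigr)^p \det\Bigl(A(G_0^*)+I_t\otimes \Bigl(\bigl(a-\tfrac{b^2pm}{r(k-1)+c(m-1)-\lambda}\bigr)J_p-(a+\lambda)I_p\Bigr)\Bigr).$$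
   Context: A hypergraph $G^*=(V,E)$ has a finite vertex set $V$ and a set $E$ of hyperedges, each a subset of $V$ of size at least $2$. It is $k$-uniform if every hyperedge has exactly $k$ vertices. The degree of a vertex is the number of hyperedges containing it; $G^*$ is $(k,r)$-regular if it is $k$-uniform and every vertex has degree $r$. The adjacency matrix $A(G^*)$ (rows and columns indexed by the vertices) has $(i,j)$ entry equal to the number of hyperedges containing both $v_i$ and $v_j$ if $i\ne j$, and $0$ on the diagonal. For a square matrix $M$, $P_M(\lambda)=\det(M-\lambda I)$. $J_n$ is the $n\times n$ all-ones matrix, $J_{p,q}$ the $p\times q$ all-ones matrix, $I_n$ the identity, $\otimes$ the Kronecker product. Binomial coefficients $\binom{x}{y}$ are $0$ when $y>x$. Join: for $k$-uniform hypergraphs $G_1^*,G_2^*$ on disjoint vertex sets $V_1,V_2$, $G_1^*\oplus G_2^*$ has vertex set $V_1\cup V_2$ and hyperedges $E(G_1^*)\cup E(G_2^*)\cup E_0$, where $E_0$ is the set of all $k$-subsets of $V_1\cup V_2$ meeting both $V_1$ and $V_2$. For $V_1'\subseteq V_1$, $G_1^*[V_1']$ is the subhypergraph induced by $V_1'$ (hyperedges of $G_1^*$ contained in $V_1'$), and $G_1^*[V_1']\circledast G_2^*$ has vertex set $V_1\cup V_2$ and hyperedge set $E(G_1^*)\cup E(G_1^*[V_1']\oplus G_2^*)$. Generalized corona: given $G_0^*$ with partition $\{U_1,\dots,U_t\}$, $|U_i|=p$, and $k$-uniform $G_1^*,\dots,G_t^*$, take $p$ copies $G_i^{*(1)},\dots,G_i^{*(p)}$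 of each $G_i^*$ (all copies pairwise vertex-disjoint and disjoint from $V_0$); $G_0^*\odot_p^t G_i^*$ is the $k$-uniform hypergraph $\bigcup_{i=1}^t\bigcup_{j=1}^p G_0^*[U_i]\circledast G_i^{*(j)}$ (union of vertex sets and of hyperedge sets). -}

module Defs where

open import Level using (Level; _⊔_) renaming (suc to lsuc)
open import Algebra.Bundles using (CommutativeRing)
open import Data.Nat as ℕ using (ℕ; zero; suc; _∸_; _≤_)
open import Data.Fin as Fin using (Fin; zero; suc; punchIn; toℕ; combine; remQuot; _↑ˡ_; _↑ʳ_)
open import Data.Fin.Subset using (Subset; _∈_; ∣_∣)
open import Data.Fin.Subset.Properties using (_∈?_)
open import Data.List using (List; length; filter)
open import Data.List.Relation.Unary.All using (All)
open import Data.Product using (_×_; _,_; ∃; ∃-syntax; Σ-syntax)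
open import Data.Sum using (_⊎_)
open import Relation.Nullary using (¬_; yes; no)
open import Relation.Nullary.Decidable using (_×-dec_)
open import Relation.Binary.PropositionalEquality using (_≡_)
import Data.List.Membership.Propositional as LMem

-- Fields: a commutative ring with 0 ≠ 1 in which every nonzero element
-- has a multiplicative inverse.  (The paper works over ℝ, which is not
-- available in agda-stdlib.)

record Field (c ℓ : Level) : Set (lsuc (c ⊔ ℓ)) where
  field
    commutativeRing : CommutativeRing c ℓ
  open CommutativeRing commutativeRing public
  field
    0≉1     : ¬ (0# ≈ 1#)
    inverse : ∀ x → ¬ (x ≈ 0#) → ∃ λ y → x * y ≈ 1#

module _ {c ℓ : Level} (R : CommutativeRing c ℓ) where
  open CommutativeRing R using (Carrier; 0#; 1#; _+_; _*_; -_; _-_)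

  Matrix : ℕ → Set c
  Matrix n = Fin n → Fin n → Carrier

  fromℕ : ℕ → Carrier
  fromℕ zero    = 0#
  fromℕ (suc n) = 1# + fromℕ n

  pow : Carrier → ℕ → Carrier
  pow x zero    = 1#
  pow x (suc n) = x * pow x n

  sgn : ℕ → Carrier
  sgn zero    = 1#
  sgn (suc n) = - sgn n

  sumFin : ∀ {n} → (Fin n → Carrier) → Carrier
  sumFin {zero}  f = 0#
  sumFin {suc n} f = f zero + sumFin (λ i → f (suc i))

  prodFin : ∀ {n} → (Fin n → Carrier) → Carrier
  prodFin {zero}  f = 1#
  prodFin {suc n} f = f zero * prodFin (λ i → f (suc i))

  det : ∀ {n} → Matrix n → Carrier
  det {zero}  M = 1#
  det {suc n} M =
    sumFin (λ j → sgn (toℕ j) * (M zero j * det (λ a b → M (suc a) (punchIn j b))))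

  I : ∀ n → Matrix n
  I n i j with i Fin.≟ j
  ... | yes _ = 1#
  ... | no  _ = 0#

  J : ∀ n → Matrix n
  J n i j = 1#

  _⊞_ : ∀ {n} → Matrix n → Matrix n → Matrix n
  (M ⊞ N) i j = M i j + N i j

  _⊟_ : ∀ {n} → Matrix n → Matrix n → Matrix n
  (M ⊟ N) i j = M i j - N i j

  _·_ : ∀ {n} → Carrier → Matrix n → Matrix n
  (x · M) i j = x * M i j

  -- Kronecker product; index (i,j) ↦ combine i j, i.e. row i*p + j
  _⊗_ : ∀ {t p} → Matrix t → Matrix p → Matrix (t ℕ.* p)
  _⊗_ {t} {p} A B u v with remQuot p u | remQuot p v
  ... | (i , j) | (i' , j') = A i i' * B j j'

  charPoly : ∀ {n} → Matrix n → Carrier → Carrier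
  charPoly {n} M x = det (M ⊟ (x · I n))

Hypergraph : ℕ → Set
Hypergraph N = List (Subset N)

module _ {N : ℕ} where
  open LMem using () renaming (_∈_ to _∈ₗ_)

  Uniform : ℕ → Hypergraph N → Set
  Uniform k H = All (λ e → ∣ e ∣ ≡ k) H

  degree : Hypergraph N → Fin N → ℕ
  degree H v = length (filter (λ e → v ∈? e) H)

  Regular : ℕ → ℕ → Hypergraph N → Set
  Regular k r H = Uniform k H × (∀ v → degree H v ≡ r)

  adjℕ : Hypergraph N → Fin N → Fin N → ℕ
  adjℕ H i j with i Fin.≟ j
  ... | yes _ = 0
  ... | no  _ = length (filter (λ e → (i ∈? e) ×-dec (j ∈? e)) H)

adjacency : ∀ {c ℓ} (R : CommutativeRing c ℓ) {N} → Hypergraph N → Matrix R N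
adjacency R H i j = fromℕ R (adjℕ H i j)

-- Vertex set of G₀*: Fin (t * p), where vertex combine i q (= i*p+q)
-- is the q-th vertex of the part U_i (so U_1 comes first, etc.).
-- Vertex set of the corona: Fin (t * p + (t * p) * m); the first t*p
-- vertices are V₀, and vertex w of the j-th copy of G_i* is
-- (t*p) ↑ʳ combine (combine i j) w.

coronaOrder : (t p m : ℕ) → ℕ
coronaOrder t p m = t ℕ.* p ℕ.+ (t ℕ.* p) ℕ.* m

module _ (t p m : ℕ) where

  baseV : Fin (t ℕ.* p) → Fin (coronaOrder t p m)
  baseV u = u ↑ˡ ((t ℕ.* p) ℕ.* m)

  copyV : Fin t → Fin p → Fin m → Fin (coronaOrder t p m)
  copyV i j w = (t ℕ.* p) ↑ʳ combine (combine i j) w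

  IsImage : ∀ {M} → (Fin M → Fin (coronaOrder t p m)) → Subset M
            → Subset (coronaOrder t p m) → Set
  IsImage g f e = ∀ x → (x ∈ e → ∃[ y ] (y ∈ f × g y ≡ x))
                      × (∀ y → y ∈ f → g y ∈ e)

  InPart : Fin t → Fin (coronaOrder t p m) → Set
  InPart i x = ∃[ q ] x ≡ baseV (combine i q)

  InCopy : Fin t → Fin p → Fin (coronaOrder t p m) → Set
  InCopy i j x = ∃[ w ] x ≡ copyV i j w

  CoronaEdge : (k : ℕ) → Hypergraph (t ℕ.* p) → (Fin t → Hypergraph m)
               → Subset (coronaOrder t p m) → Set
  CoronaEdge k G₀ Gs e =
      (∃[ f ] (f ∈ₗ G₀ × IsImage baseV f e))
    ⊎ (∃[ i ] ∃[ j ] ∃[ f ] (f ∈ₗ Gs i × IsImage (copyV i j) f e))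
    ⊎ (∃[ i ] ∃[ j ] ( ∣ e ∣ ≡ k
                     × (∀ x → x ∈ e → InPart i x ⊎ InCopy i j x)
                     × (∃[ x ] (x ∈ e × InPart i x))
                     × (∃[ x ] (x ∈ e × InCopy i j x))))
    where open LMem using () renaming (_∈_ to _∈ₗ_)

choose : ℕ → ℕ → ℕ
choose n       zero    = 1
choose zero    (suc k) = 0
choose (suc n) (suc k) = choose n k ℕ.+ choose n (suc k)

coefA : (k p m : ℕ) → ℕ
coefA k zero          m = 0
coefA k (suc zero)    m = 0
coefA k (suc (suc q)) m =
  suc (suc q) ℕ.* (choose (suc (suc q) ℕ.+ m ∸ 2) (k ∸ 2) ∸ choose q (k ∸ 2))

coefB : (k p m : ℕ) → ℕ
coefB k p m = choose (p ℕ.+ m ∸ 2) (k ∸ 2)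

coefC : (k p m : ℕ) → ℕ
coefC k p m = choose (p ℕ.+ m ∸ 2) (k ∸ 2) ∸ choose (m ∸ 2) (k ∸ 2)

{-# OPTIONS --safe #-}
module Submission where

-- A hyperedge of G* through two vertices is the image of a hyperedge of G₀ or of a
-- copy of some G_i*, or a cross hyperedge: a k-subset of U_i ∪ W meeting both, W a copy of G_i*.
-- Counting the cross hyperedges through a pair of vertices by binomial coefficients gives the
-- entries of A(G*): a + A(G₀) inside a part U_i, A(G₀) between parts, b between U_i and its
-- copies, c + A(G_i*) inside a copy, 0 elsewhere.  Each row of the copy block Y_i - λ I sums to
-- s - λ with s = r(k - 1) + c(m - 1), so adding - b y (y = (s - λ)⁻¹) times the columns of all
-- copies of G_i* to each column of U_i clears the copy rows in the columns of V₀.  The matrix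
-- becomes block triangular: the copy block is block diagonal with p blocks Y_i - λ I for each i,
-- and the V₀ block is the Schur complement A(G₀) + I_t ⊗ ((a - b² p m y) J_p - (a + λ) I_p).
-- The determinant, defined by expansion along the first row, is multilinear and alternating
-- in the columns, which yields invariance under such column operations and the product
-- formula for block triangular matrices.

open import Defs
open import Data.Nat using (ℕ; _≤_; _∸_)
open import Data.Fin using (Fin)
open import Data.Product using (_×_)
open import Data.List.Relation.Unary.Unique.Propositional using (Unique)
open import Data.List.Membership.Propositional using (_∈_)
open import Relation.Nullary using (¬_)
open import Data.Nat as ℕ using ()
open import Algebra.Bundles using (CommutativeMonoid; CommutativeRing)
import Data.Nat.Properties
import Relation.Binary.PropositionalEquality as ≡

module FinSum {a ℓ} (M : CommutativeMonoid a ℓ) where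

  open import Data.Nat.Base as ℕ using (zero; suc)
  open import Data.Fin.Base using (Fin; zero; suc; punchIn; _↑ˡ_; _↑ʳ_; combine)
  open import Data.Fin.Properties using (punchInᵢ≢i)
  open import Data.Vec.Functional using (Vector)
  open import Relation.Binary.PropositionalEquality using (_≢_)
  open CommutativeMonoid M renaming (_∙_ to _+_; ε to 0#; ∙-congˡ to +-congˡ;
    identityˡ to +-identityˡ; identityʳ to +-identityʳ; assoc to +-assoc)
  open import Algebra.Properties.CommutativeMonoid.Sum M public

  sum-↑ : ∀ m {n} (f : Vector Carrier (m ℕ.+ n)) →
          sum f ≈ sum (λ i → f (i ↑ˡ n)) + sum (λ j → f (m ↑ʳ j))
  sum-↑ zero    f = sym (+-identityˡ _)
  sum-↑ (suc m) f = trans (+-congˡ (sum-↑ m (λ i → f (suc i)))) (sym (+-assoc _ _ _))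

  sum-combine : ∀ m {n} (f : Vector Carrier (m ℕ.* n)) →
                sum f ≈ sum {m} (λ i → sum {n} (λ j → f (combine i j)))
  sum-combine zero    f = refl
  sum-combine (suc m) {n} f =
    trans (sum-↑ n {m ℕ.* n} f) (+-congˡ (sum-combine m (λ i → f (n ↑ʳ i))))

  sum-zero : ∀ {n} {f : Vector Carrier n} → (∀ i → f i ≈ 0#) → sum f ≈ 0#
  sum-zero {n} f≈0 = trans (sum-cong-≋ f≈0) (sum-replicate-zero n)

  sum-single : ∀ {n} (c : Fin n) {f : Vector Carrier n} → (∀ i → i ≢ c → f i ≈ 0#) → sum f ≈ f c
  sum-single {suc n} c {f} f≈0 = begin
    sum f                              ≈⟨ sum-remove f ⟩
    f c + sum (λ i → f (punchIn c i))  ≈⟨ +-congˡ (sum-zero (λ i → f≈0 _ (punchInᵢ≢i c i))) ⟩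
    f c + 0#                           ≈⟨ +-identityʳ _ ⟩
    f c                                ∎
    where open import Relation.Binary.Reasoning.Setoid setoid

module ℕΣ = FinSum Data.Nat.Properties.+-0-commutativeMonoid

ℕΣ-const : ∀ n c → ℕΣ.sum {n} (λ _ → c) ≡.≡ n ℕ.* c
ℕΣ-const ℕ.zero    c = ≡.refl
ℕΣ-const (ℕ.suc n) c = ≡.cong (c ℕ.+_) (ℕΣ-const n c)

module RingSums {c ℓ} (R : CommutativeRing c ℓ) where

  open import Data.Nat.Base as ℕ using (ℕ; zero; suc)
  open import Data.Fin.Base using (Fin; zero; suc)
  import Data.Nat.Properties as ℕ
  open import Relation.Binary.PropositionalEquality as ≡ using (_≡_; cong; cong₂)
  open CommutativeRing R hiding (zero)
  open import Relation.Binary.Reasoning.Setoid setoid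
  open import Algebra.Definitions.RawMonoid +-rawMonoid using () renaming (_×_ to _×′_)
  open import Algebra.Properties.Semiring.Mult semiring using (×-homo-+)
  open import Algebra.Properties.AbelianGroup +-abelianGroup using (⁻¹-∙-comm)

  module Σ = FinSum +-commutativeMonoid
  module Π = FinSum *-commutativeMonoid
  open import Algebra.Properties.Semiring.Sum semiring public using (*-distribˡ-sum; *-distribʳ-sum)

  sumFin≡∑ : ∀ {n} (f : Fin n → Carrier) → sumFin R f ≡ Σ.sum f
  sumFin≡∑ {zero}  f = ≡.refl
  sumFin≡∑ {suc n} f = cong (f zero +_) (sumFin≡∑ (λ i → f (suc i)))

  prodFin≡∏ : ∀ {n} (f : Fin n → Carrier) → prodFin R f ≡ Π.sum f
  prodFin≡∏ {zero}  f = ≡.refl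
  prodFin≡∏ {suc n} f = cong (f zero *_) (prodFin≡∏ (λ i → f (suc i)))

  ∏-const : ∀ n x → Π.sum {n} (λ _ → x) ≡ pow R x n
  ∏-const zero    x = ≡.refl
  ∏-const (suc n) x = cong (x *_) (∏-const n x)

  fromℕ≡×1# : ∀ n → fromℕ R n ≡ n ×′ 1#
  fromℕ≡×1# zero    = ≡.refl
  fromℕ≡×1# (suc n) = cong (1# +_) (fromℕ≡×1# n)

  fromℕ-+ : ∀ m n → fromℕ R (m ℕ.+ n) ≈ fromℕ R m + fromℕ R n
  fromℕ-+ m n = begin
    fromℕ R (m ℕ.+ n)        ≡⟨ fromℕ≡×1# (m ℕ.+ n) ⟩
    (m ℕ.+ n) ×′ 1#           ≈⟨ ×-homo-+ 1# m n ⟩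
    m ×′ 1# + n ×′ 1#          ≡⟨ cong₂ _+_ (fromℕ≡×1# m) (fromℕ≡×1# n) ⟨
    fromℕ R m + fromℕ R n    ∎

  fromℕ-∑ : ∀ {n} (f : Fin n → ℕ) → fromℕ R (ℕΣ.sum f) ≈ Σ.sum (λ i → fromℕ R (f i))
  fromℕ-∑ {zero}  f = refl
  fromℕ-∑ {suc n} f = trans (fromℕ-+ (f zero) _) (+-congˡ (fromℕ-∑ (λ i → f (suc i))))

  ∑-const : ∀ n x → Σ.sum {n} (λ _ → x) ≈ fromℕ R n * x
  ∑-const zero    x = sym (zeroˡ x)
  ∑-const (suc n) x = begin
    x + Σ.sum {n} (λ _ → x)  ≈⟨ +-cong (sym (*-identityˡ x)) (∑-const n x) ⟩
    1# * x + fromℕ R n * x   ≈⟨ distribʳ x 1# (fromℕ R n) ⟨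
    fromℕ R (suc n) * x      ∎

  fromℕ-pred : ∀ n → Fin n → fromℕ R n ≈ 1# + fromℕ R (n ∸ 1)
  fromℕ-pred (suc n) _ = refl

  x+-[x+y]≈-y : ∀ x y → x + - (x + y) ≈ - y
  x+-[x+y]≈-y x y = begin
    x + - (x + y)     ≈⟨ +-congˡ (⁻¹-∙-comm x y) ⟨
    x + (- x + - y)   ≈⟨ +-assoc x (- x) (- y) ⟨
    (x + - x) + - y   ≈⟨ +-congʳ (-‿inverseʳ x) ⟩
    0# + - y          ≈⟨ +-identityˡ (- y) ⟩
    - y               ∎

module FinSplit where

  open import Data.Nat.Base as ℕ using (ℕ)
  open import Data.Fin.Base using (Fin; _↑ˡ_; _↑ʳ_; splitAt; combine; remQuot)
  open import Data.Fin.Properties using (splitAt⁻¹-↑ˡ; splitAt⁻¹-↑ʳ; splitAt-↑ˡ; splitAt-↑ʳ; combine-remQuot)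
  open import Data.Product using (proj₁; proj₂)
  open import Data.Sum using (inj₁; inj₂)
  open import Relation.Binary.PropositionalEquality using (_≢_; subst; trans; sym; cong)

  data SplitView (n : ℕ) {m : ℕ} : Fin (n ℕ.+ m) → Set where
    left  : ∀ u → SplitView n (u ↑ˡ m)
    right : ∀ v → SplitView n (n ↑ʳ v)

  splitView : ∀ n {m} (j : Fin (n ℕ.+ m)) → SplitView n j
  splitView n j with splitAt n j in eq
  ... | inj₁ u = subst (SplitView n) (splitAt⁻¹-↑ˡ eq) (left u)
  ... | inj₂ v = subst (SplitView n) (splitAt⁻¹-↑ʳ eq) (right v)

  combine-elim : ∀ {a} {n m} {P : Fin (n ℕ.* m) → Set a} → (∀ i j → P (combine i j)) → ∀ u → P u
  combine-elim {n = n} {m} {P} h u = subst P (combine-remQuot {n} m u) (h (proj₁ (remQuot {n} m u)) (proj₂ (remQuot {n} m u)))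

  ↑ˡ≢↑ʳ : ∀ {n m} (u : Fin n) (v : Fin m) → u ↑ˡ m ≢ n ↑ʳ v
  ↑ˡ≢↑ʳ {n} {m} u v eq with trans (sym (splitAt-↑ˡ n u m)) (trans (cong (splitAt n) eq) (splitAt-↑ʳ n m v))
  ... | ()

module Determinant {c ℓ} (R : CommutativeRing c ℓ) where

  open import Data.Nat.Base as ℕ using (ℕ; zero; suc; _<_; _≤_; s≤s; z≤n)
  import Data.Nat.Properties as ℕ
  open import Data.Fin.Base as Fin using (Fin; zero; suc; toℕ; punchIn; punchOut; _↑ˡ_; _↑ʳ_; combine; splitAt)
  import Data.Fin.Properties as Fin
  open import Data.Product using (_×_; _,_; proj₁; proj₂)
  open import Data.Sum using (_⊎_; inj₁; inj₂; [_,_]′)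
  open import Data.Bool.Base using (if_then_else_)
  open import Function.Base using (_∘_)
  open import Relation.Binary.PropositionalEquality as ≡ using (_≡_; _≢_)
  open import Relation.Nullary using (¬_; Dec; does; yes; no; contradiction)
  open import Relation.Nullary.Decidable using (dec-true; dec-false)
  open import Relation.Binary.Definitions using (tri<; tri≈; tri>)
  open CommutativeRing R hiding (zero)
  open RingSums R
  open FinSplit
  open import Relation.Binary.Reasoning.Setoid setoid
  open import Algebra.Properties.Ring ring using (-0#≈0#)
  open import Algebra.Properties.AbelianGroup +-abelianGroup using (inverseʳ-unique)
  open import Algebra.Solver.Ring.NaturalCoefficients.Default commutativeSemiring using (solve; _:=_; _:+_; _:*_)

  private
    Mat : ℕ → Set c
    Mat = Matrix R

  minor : ∀ {n} → Mat (suc n) → Fin (suc n) → Mat n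
  minor M j a b = M (suc a) (punchIn j b)

  expansionTerm : ∀ {n} → Mat (suc n) → Fin (suc n) → Carrier
  expansionTerm M j = sgn R (toℕ j) * (M zero j * det R (minor M j))

  det-expand : ∀ {n} (M : Mat (suc n)) → det R M ≈ Σ.sum (expansionTerm M)
  det-expand M = reflexive (sumFin≡∑ (expansionTerm M))

  expansionTerm-minor≈0 : ∀ {n} (M : Mat (suc n)) j → det R (minor M j) ≈ 0# → expansionTerm M j ≈ 0#
  expansionTerm-minor≈0 M j minor≈0 = trans (*-congˡ (trans (*-congˡ minor≈0) (zeroʳ _))) (zeroʳ _)

  expansionTerm-entry≈0 : ∀ {n} (M : Mat (suc n)) j → M zero j ≈ 0# → expansionTerm M j ≈ 0#
  expansionTerm-entry≈0 M j entry≈0 = trans (*-congˡ (trans (*-congʳ entry≈0) (zeroˡ _))) (zeroʳ _)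

  det-cong : ∀ {n} {M N : Mat n} → (∀ i j → M i j ≈ N i j) → det R M ≈ det R N
  det-cong {zero}          _   = refl
  det-cong {suc n} {M} {N} M≈N = begin
    det R M                  ≈⟨ det-expand M ⟩
    Σ.sum (expansionTerm M)  ≈⟨ Σ.sum-cong-≋ term≈ ⟩
    Σ.sum (expansionTerm N)  ≈⟨ det-expand N ⟨
    det R N                  ∎
    where
    term≈ : ∀ j → expansionTerm M j ≈ expansionTerm N j
    term≈ j = *-congˡ (*-cong (M≈N zero j) (det-cong (λ a b → M≈N (suc a) (punchIn j b))))

  I-diag : ∀ n i → I R n i i ≈ 1#
  I-diag n i with i Fin.≟ i
  ... | yes _   = refl
  ... | no  i≢i = contradiction ≡.refl i≢i

  I-off : ∀ n {i j} → i ≢ j → I R n i j ≈ 0#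
  I-off n {i} {j} i≢j with i Fin.≟ j
  ... | yes i≡j = contradiction i≡j i≢j
  ... | no  _   = refl

  ⊗-combine : ∀ {t p} (A : Mat t) (B : Mat p) i q i′ q′ → _⊗_ R A B (combine i q) (combine i′ q′) ≡ A i i′ * B q q′
  ⊗-combine {t} {p} A B i q i′ q′ = ≡.cong₂ (λ z z′ → A (proj₁ z) (proj₁ z′) * B (proj₂ z) (proj₂ z′))
                                             (Fin.remQuot-combine {t} {p} i q) (Fin.remQuot-combine {t} {p} i′ q′)

  -- Column replacement and linearity

  replaceColumn : ∀ {n} → Mat n → Fin n → (Fin n → Carrier) → Mat n
  replaceColumn M c v i j with j Fin.≟ c
  ... | yes _ = v i
  ... | no  _ = M i j

  module _ {n} (M : Mat n) (c : Fin n) (v : Fin n → Carrier) where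

    replaceColumn-at : ∀ i → replaceColumn M c v i c ≡ v i
    replaceColumn-at i with c Fin.≟ c
    ... | yes _   = ≡.refl
    ... | no  c≢c = contradiction ≡.refl c≢c

    replaceColumn-off : ∀ i {j} → j ≢ c → replaceColumn M c v i j ≡ M i j
    replaceColumn-off i {j} j≢c with j Fin.≟ c
    ... | yes j≡c = contradiction j≡c j≢c
    ... | no  _   = ≡.refl

  module _ {n} (M : Mat (suc n)) (c : Fin (suc n)) (v : Fin (suc n) → Carrier) where

    minor-replaceColumn-at : ∀ a b → minor (replaceColumn M c v) c a b ≡ minor M c a b
    minor-replaceColumn-at a b = replaceColumn-off M c v (suc a) (Fin.punchInᵢ≢i c b)

    minor-replaceColumn-off : ∀ {j} (j≢c : j ≢ c) a b →
      minor (replaceColumn M c v) j a b ≡ replaceColumn (minor M j) (punchOut j≢c) (v ∘ suc) a b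
    minor-replaceColumn-off {j} j≢c a b with b Fin.≟ punchOut j≢c
    ... | yes ≡.refl = ≡.trans (≡.cong (replaceColumn M c v (suc a)) (Fin.punchIn-punchOut j≢c))
                              (replaceColumn-at M c v (suc a))
    ... | no  b≢c′   = replaceColumn-off M c v (suc a) punchIn≢c
      where
      punchIn≢c : punchIn j b ≢ c
      punchIn≢c eq = b≢c′ (Fin.punchIn-injective j _ _ (≡.trans eq (≡.sym (Fin.punchIn-punchOut j≢c))))

  module _ {n} (M : Mat (suc n)) (c : Fin (suc n)) (v : Fin (suc n) → Carrier) where

    expansionTerm-replaceColumn-at :
      expansionTerm (replaceColumn M c v) c ≈ sgn R (toℕ c) * (v zero * det R (minor M c))
    expansionTerm-replaceColumn-at = *-congˡ (*-cong (reflexive (replaceColumn-at M c v zero))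
                                                     (det-cong (λ a b → reflexive (minor-replaceColumn-at M c v a b))))

    expansionTerm-replaceColumn-off : ∀ {j} (j≢c : j ≢ c) →
      expansionTerm (replaceColumn M c v) j ≈ sgn R (toℕ j) * (M zero j * det R (replaceColumn (minor M j) (punchOut j≢c) (v ∘ suc)))
    expansionTerm-replaceColumn-off j≢c = *-congˡ (*-cong (reflexive (replaceColumn-off M c v zero j≢c))
                                                          (det-cong (λ a b → reflexive (minor-replaceColumn-off M c v j≢c a b))))

  det-linear : ∀ {n} (M : Mat n) c α β (u v : Fin n → Carrier) →
    det R (replaceColumn M c (λ i → α * u i + β * v i))
      ≈ α * det R (replaceColumn M c u) + β * det R (replaceColumn M c v)
  det-linear {suc n} M c α β u v = begin
    det R L                                                   ≈⟨ det-expand L ⟩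
    Σ.sum (expansionTerm L)                                   ≈⟨ Σ.sum-cong-≋ (λ j → term≈ (j Fin.≟ c)) ⟩
    Σ.sum (λ j → α * expansionTerm U j + β * expansionTerm V j)
      ≈⟨ Σ.∑-distrib-+ (λ j → α * expansionTerm U j) (λ j → β * expansionTerm V j) ⟩
    Σ.sum (λ j → α * expansionTerm U j) + Σ.sum (λ j → β * expansionTerm V j)
      ≈⟨ +-cong (*-distribˡ-sum α (expansionTerm U)) (*-distribˡ-sum β (expansionTerm V)) ⟨
    α * Σ.sum (expansionTerm U) + β * Σ.sum (expansionTerm V) ≈⟨ +-cong (*-congˡ (det-expand U)) (*-congˡ (det-expand V)) ⟨
    α * det R U + β * det R V                                 ∎
    where
    L U V : Mat (suc n)
    L = replaceColumn M c (λ i → α * u i + β * v i)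
    U = replaceColumn M c u
    V = replaceColumn M c v
    term≈ : ∀ {j} → Dec (j ≡ c) → expansionTerm L j ≈ α * expansionTerm U j + β * expansionTerm V j
    term≈ (yes ≡.refl) = begin
      expansionTerm L c
        ≈⟨ expansionTerm-replaceColumn-at M c _ ⟩
      sgn R (toℕ c) * ((α * u zero + β * v zero) * det R (minor M c))
        ≈⟨ solve 6 (λ s a b x y d → s :* ((a :* x :+ b :* y) :* d) := a :* (s :* (x :* d)) :+ b :* (s :* (y :* d)))
                   refl (sgn R (toℕ c)) α β (u zero) (v zero) (det R (minor M c)) ⟩
      α * (sgn R (toℕ c) * (u zero * det R (minor M c))) + β * (sgn R (toℕ c) * (v zero * det R (minor M c)))
        ≈⟨ +-cong (*-congˡ (expansionTerm-replaceColumn-at M c u)) (*-congˡ (expansionTerm-replaceColumn-at M c v)) ⟨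
      α * expansionTerm U c + β * expansionTerm V c ∎
    term≈ {j} (no j≢c) = begin
      expansionTerm L j
        ≈⟨ expansionTerm-replaceColumn-off M c _ j≢c ⟩
      sgn R (toℕ j) * (M zero j * det R (replaceColumn (minor M j) c′ (λ i → α * u (suc i) + β * v (suc i))))
        ≈⟨ *-congˡ (*-congˡ (det-linear (minor M j) c′ α β (u ∘ suc) (v ∘ suc))) ⟩
      sgn R (toℕ j) * (M zero j * (α * det R (replaceColumn (minor M j) c′ (u ∘ suc)) + β * det R (replaceColumn (minor M j) c′ (v ∘ suc))))
        ≈⟨ solve 6 (λ s x a b du dv → s :* (x :* (a :* du :+ b :* dv)) := a :* (s :* (x :* du)) :+ b :* (s :* (x :* dv)))
                   refl (sgn R (toℕ j)) (M zero j) α β _ _ ⟩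
      α * (sgn R (toℕ j) * (M zero j * det R (replaceColumn (minor M j) c′ (u ∘ suc))))
        + β * (sgn R (toℕ j) * (M zero j * det R (replaceColumn (minor M j) c′ (v ∘ suc))))
        ≈⟨ +-cong (*-congˡ (expansionTerm-replaceColumn-off M c u j≢c)) (*-congˡ (expansionTerm-replaceColumn-off M c v j≢c)) ⟨
      α * expansionTerm U j + β * expansionTerm V j ∎
      where
      c′ : Fin n
      c′ = punchOut j≢c

  replaceColumn-self : ∀ {n} (M : Mat n) c i j → replaceColumn M c (λ i → M i c) i j ≡ M i j
  replaceColumn-self M c i j with j Fin.≟ c
  ... | yes ≡.refl = ≡.refl
  ... | no  _      = ≡.refl

  replaceColumn-comm : ∀ {n} (M : Mat n) {c₁ c₂} → c₁ ≢ c₂ → ∀ u v i j →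
    replaceColumn (replaceColumn M c₂ v) c₁ u i j ≡ replaceColumn (replaceColumn M c₁ u) c₂ v i j
  replaceColumn-comm M {c₁} {c₂} c₁≢c₂ u v i j with j Fin.≟ c₁ | j Fin.≟ c₂
  ... | yes ≡.refl | yes ≡.refl = contradiction ≡.refl c₁≢c₂
  ... | yes ≡.refl | no  _      = ≡.sym (replaceColumn-at M j u i)
  ... | no  _      | yes ≡.refl = replaceColumn-at M j v i
  ... | no  j≢c₁   | no  j≢c₂   = ≡.trans (replaceColumn-off M c₂ v i j≢c₂) (≡.sym (replaceColumn-off M c₁ u i j≢c₁))

  det-replaceColumn-cong : ∀ {n} (M : Mat n) c {u v : Fin n → Carrier} → (∀ i → u i ≈ v i) →
                           det R (replaceColumn M c u) ≈ det R (replaceColumn M c v)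
  det-replaceColumn-cong M c {u} {v} u≈v = det-cong entry≈
    where
    entry≈ : ∀ i j → replaceColumn M c u i j ≈ replaceColumn M c v i j
    entry≈ i j with j Fin.≟ c
    ... | yes _ = u≈v i
    ... | no  _ = refl

  det-additive : ∀ {n} (M : Mat n) c (u v : Fin n → Carrier) →
    det R (replaceColumn M c (λ i → u i + v i)) ≈ det R (replaceColumn M c u) + det R (replaceColumn M c v)
  det-additive M c u v = begin
    det R (replaceColumn M c (λ i → u i + v i))
      ≈⟨ det-replaceColumn-cong M c (λ i → +-cong (*-identityˡ _) (*-identityˡ _)) ⟨
    det R (replaceColumn M c (λ i → 1# * u i + 1# * v i))
      ≈⟨ det-linear M c 1# 1# u v ⟩
    1# * det R (replaceColumn M c u) + 1# * det R (replaceColumn M c v)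
      ≈⟨ +-cong (*-identityˡ _) (*-identityˡ _) ⟩
    det R (replaceColumn M c u) + det R (replaceColumn M c v) ∎

  -- Alternation

  toℕ-punchIn-< : ∀ {n} (i : Fin (suc n)) (j : Fin n) → toℕ j < toℕ i → toℕ (punchIn i j) ≡ toℕ j
  toℕ-punchIn-< (suc i) zero    _         = ≡.refl
  toℕ-punchIn-< (suc i) (suc j) (s≤s j<i) = ≡.cong suc (toℕ-punchIn-< i j j<i)

  toℕ-punchIn-≥ : ∀ {n} (i : Fin (suc n)) (j : Fin n) → toℕ i ≤ toℕ j → toℕ (punchIn i j) ≡ suc (toℕ j)
  toℕ-punchIn-≥ zero    j       _         = ≡.refl
  toℕ-punchIn-≥ (suc i) (suc j) (s≤s i≤j) = ≡.cong suc (toℕ-punchIn-≥ i j i≤j)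

  toℕ-punchOut : ∀ {n} {i j : Fin (suc n)} (i≢j : i ≢ j) →
    (toℕ j < toℕ i × toℕ (punchOut i≢j) ≡ toℕ j) ⊎ (toℕ i < toℕ j × suc (toℕ (punchOut i≢j)) ≡ toℕ j)
  toℕ-punchOut {_}     {zero}  {zero}  i≢j = contradiction ≡.refl i≢j
  toℕ-punchOut {_}     {zero}  {suc j} i≢j = inj₂ (s≤s z≤n , ≡.refl)
  toℕ-punchOut {suc n} {suc i} {zero}  i≢j = inj₁ (s≤s z≤n , ≡.refl)
  toℕ-punchOut {suc n} {suc i} {suc j} i≢j with toℕ-punchOut (i≢j ∘ ≡.cong suc)
  ... | inj₁ (j<i , eq) = inj₁ (s≤s j<i , ≡.cong suc eq)
  ... | inj₂ (i<j , eq) = inj₂ (s≤s i<j , ≡.cong suc eq)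

  Adjacent : ∀ {n} → Fin n → Fin n → Set
  Adjacent c₁ c₂ = toℕ c₂ ≡ suc (toℕ c₁)

  adjacent⇒≢ : ∀ {n} {c₁ c₂ : Fin n} → Adjacent c₁ c₂ → c₁ ≢ c₂
  adjacent⇒≢ adj c₁≡c₂ = ℕ.1+n≢n (≡.trans (≡.sym adj) (≡.cong toℕ (≡.sym c₁≡c₂)))

  punchOut-adjacent : ∀ {n} {j c₁ c₂ : Fin (suc n)} (j≢c₁ : j ≢ c₁) (j≢c₂ : j ≢ c₂) →
                      Adjacent c₁ c₂ → Adjacent (punchOut j≢c₁) (punchOut j≢c₂)
  punchOut-adjacent j≢c₁ j≢c₂ adj with toℕ-punchOut j≢c₁ | toℕ-punchOut j≢c₂
  ... | inj₁ (_ , e₁) | inj₁ (_ , e₂) = ≡.trans e₂ (≡.trans adj (≡.cong suc (≡.sym e₁)))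
  ... | inj₂ (_ , e₁) | inj₂ (_ , e₂) = ℕ.suc-injective (≡.trans e₂ (≡.trans adj (≡.cong suc (≡.sym e₁))))
  ... | inj₁ (c₁<j , _) | inj₂ (j<c₂ , _) = contradiction (ℕ.s≤s⁻¹ (≡.subst (_ ≤_) adj j<c₂)) (ℕ.<⇒≱ c₁<j)
  ... | inj₂ (j<c₁ , _) | inj₁ (c₂<j , _) =
    contradiction (ℕ.<-trans j<c₁ (≡.subst (_ <_) (≡.sym adj) (ℕ.n<1+n _))) (ℕ.<-asym c₂<j)

  punchIn-adjacent : ∀ {n} {c₁ c₂ : Fin (suc n)} → Adjacent c₁ c₂ → ∀ b →
     (punchIn c₁ b ≡ punchIn c₂ b) ⊎ (punchIn c₁ b ≡ c₂ × punchIn c₂ b ≡ c₁)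
  punchIn-adjacent {c₁ = c₁} {c₂} adj b with ℕ.<-cmp (toℕ b) (toℕ c₁)
  ... | tri< b<c₁ _ _ = inj₁ (Fin.toℕ-injective (≡.trans (toℕ-punchIn-< c₁ b b<c₁) (≡.sym (toℕ-punchIn-< c₂ b b<c₂))))
    where b<c₂ = ≡.subst (toℕ b <_) (≡.sym adj) (ℕ.m<n⇒m<1+n b<c₁)
  ... | tri≈ _ b≡c₁ _ = inj₂ ( Fin.toℕ-injective (≡.trans (toℕ-punchIn-≥ c₁ b (ℕ.≤-reflexive (≡.sym b≡c₁)))
                                                        (≡.trans (≡.cong suc b≡c₁) (≡.sym adj)))
                            , Fin.toℕ-injective (≡.trans (toℕ-punchIn-< c₂ b b<c₂) b≡c₁))
    where b<c₂ = ≡.subst (toℕ b <_) (≡.sym adj) (s≤s (ℕ.≤-reflexive b≡c₁))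
  ... | tri> _ _ c₁<b = inj₁ (Fin.toℕ-injective (≡.trans (toℕ-punchIn-≥ c₁ b (ℕ.<⇒≤ c₁<b)) (≡.sym (toℕ-punchIn-≥ c₂ b c₂≤b))))
    where c₂≤b = ≡.subst (_≤ toℕ b) (≡.sym adj) c₁<b

  -- The two terms have opposite signs, while their entries and minors agree.
  expansionTerms-cancel : ∀ {n} (M : Mat (suc n)) {c₁ c₂} → Adjacent c₁ c₂ → (∀ i → M i c₁ ≈ M i c₂) →
                          expansionTerm M c₁ + expansionTerm M c₂ ≈ 0#
  expansionTerms-cancel M {c₁} {c₂} adj col≈ = begin
    expansionTerm M c₁ + sgn R (toℕ c₂) * (M zero c₂ * det R (minor M c₂))
      ≡⟨ ≡.cong (λ s → expansionTerm M c₁ + s * (M zero c₂ * det R (minor M c₂))) (≡.cong (sgn R) adj) ⟩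
    expansionTerm M c₁ + (- sgn R (toℕ c₁)) * (M zero c₂ * det R (minor M c₂))
      ≈⟨ +-congˡ (*-congˡ (*-cong (sym (col≈ zero)) (det-cong minors≈))) ⟩
    sgn R (toℕ c₁) * (M zero c₁ * det R (minor M c₁)) + (- sgn R (toℕ c₁)) * (M zero c₁ * det R (minor M c₁))
      ≈⟨ trans (sym (distribʳ _ _ _)) (trans (*-congʳ (-‿inverseʳ _)) (zeroˡ _)) ⟩
    0# ∎
    where
    minors≈ : ∀ a b → minor M c₂ a b ≈ minor M c₁ a b
    minors≈ a b with punchIn-adjacent adj b
    ... | inj₁ eq        = reflexive (≡.cong (M (suc a)) (≡.sym eq))
    ... | inj₂ (e₁ , e₂) = ≡.subst₂ (λ x y → M (suc a) x ≈ M (suc a) y) (≡.sym e₂) (≡.sym e₁) (col≈ (suc a))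

  det-adjacentEqualColumns : ∀ {n} (M : Mat n) {c₁ c₂} → Adjacent c₁ c₂ →
                             (∀ i → M i c₁ ≈ M i c₂) → det R M ≈ 0#
  det-adjacentEqualColumns {suc n} M {c₁} {c₂} adj col≈ = begin
    det R M                                                   ≈⟨ det-expand M ⟩
    Σ.sum (expansionTerm M)                                   ≈⟨ Σ.sum-remove {i = c₁} (expansionTerm M) ⟩
    expansionTerm M c₁ + Σ.sum (expansionTerm M ∘ punchIn c₁) ≈⟨ +-congˡ (Σ.sum-single b₂ others≈0) ⟩
    expansionTerm M c₁ + expansionTerm M (punchIn c₁ b₂)
      ≡⟨ ≡.cong (λ c → expansionTerm M c₁ + expansionTerm M c) (Fin.punchIn-punchOut c₁≢c₂) ⟩
    expansionTerm M c₁ + expansionTerm M c₂                   ≈⟨ expansionTerms-cancel M adj col≈ ⟩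
    0#                                                        ∎
    where
    c₁≢c₂ : c₁ ≢ c₂
    c₁≢c₂ = adjacent⇒≢ adj
    b₂ : Fin n
    b₂ = punchOut c₁≢c₂
    term≈0 : ∀ j → j ≢ c₁ → j ≢ c₂ → expansionTerm M j ≈ 0#
    term≈0 j j≢c₁ j≢c₂ = expansionTerm-minor≈0 M j
      (det-adjacentEqualColumns (minor M j) (punchOut-adjacent j≢c₁ j≢c₂ adj)
        (λ a → ≡.subst₂ (λ x y → M (suc a) x ≈ M (suc a) y)
                 (≡.sym (Fin.punchIn-punchOut j≢c₁)) (≡.sym (Fin.punchIn-punchOut j≢c₂)) (col≈ (suc a))))
    others≈0 : ∀ b → b ≢ b₂ → expansionTerm M (punchIn c₁ b) ≈ 0#
    others≈0 b b≢b₂ = term≈0 (punchIn c₁ b) (Fin.punchInᵢ≢i c₁ b)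
      (λ eq → b≢b₂ (Fin.punchIn-injective c₁ b b₂ (≡.trans eq (≡.sym (Fin.punchIn-punchOut c₁≢c₂)))))

  replaceColumns : ∀ {n} → Mat n → Fin n → Fin n → (u v : Fin n → Carrier) → Mat n
  replaceColumns M c₁ c₂ u v = replaceColumn (replaceColumn M c₂ v) c₁ u

  module _ {n} (M : Mat n) {c₁ c₂ : Fin n} (c₁≢c₂ : c₁ ≢ c₂) where

    replaceColumns-at₁ : ∀ u v i → replaceColumns M c₁ c₂ u v i c₁ ≡ u i
    replaceColumns-at₁ u v = replaceColumn-at _ c₁ u

    replaceColumns-at₂ : ∀ u v i → replaceColumns M c₁ c₂ u v i c₂ ≡ v i
    replaceColumns-at₂ u v i = ≡.trans (replaceColumn-off _ c₁ u i (c₁≢c₂ ∘ ≡.sym)) (replaceColumn-at M c₂ v i)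

    replaceColumns-off : ∀ u v i {j} → j ≢ c₁ → j ≢ c₂ → replaceColumns M c₁ c₂ u v i j ≡ M i j
    replaceColumns-off u v i j≢c₁ j≢c₂ = ≡.trans (replaceColumn-off _ c₁ u i j≢c₁) (replaceColumn-off M c₂ v i j≢c₂)

    replaceColumns-self : ∀ i j → replaceColumns M c₁ c₂ (λ i → M i c₁) (λ i → M i c₂) i j ≡ M i j
    replaceColumns-self i j = byCases (j Fin.≟ c₁) (j Fin.≟ c₂)
      where
      byCases : Dec (j ≡ c₁) → Dec (j ≡ c₂) → replaceColumns M c₁ c₂ (λ i → M i c₁) (λ i → M i c₂) i j ≡ M i j
      byCases (yes ≡.refl) _            = replaceColumns-at₁ _ _ i
      byCases (no  _)      (yes ≡.refl) = replaceColumns-at₂ _ _ i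
      byCases (no  j≢c₁)   (no  j≢c₂)   = replaceColumns-off _ _ i j≢c₁ j≢c₂

  det-replaceColumns-swap : ∀ {n} (M : Mat n) {c₁ c₂} → Adjacent c₁ c₂ → ∀ u v →
    det R (replaceColumns M c₁ c₂ u v) ≈ - det R (replaceColumns M c₁ c₂ v u)
  det-replaceColumns-swap {n} M {c₁} {c₂} adj u v = inverseʳ-unique (f v u) (f u v) (begin
    f v u + f u v                          ≈⟨ +-cong (+-identityˡ _) (+-identityʳ _) ⟨
    (0# + f v u) + (f u v + 0#)            ≈⟨ +-cong (+-congʳ (diag≈0 v)) (+-congˡ (diag≈0 u)) ⟨
    (f v v + f v u) + (f u v + f u u)      ≈⟨ +-cong (additiveʳ v v u) (additiveʳ u v u) ⟨
    f v (λ i → v i + u i) + f u (λ i → v i + u i) ≈⟨ det-additive _ c₁ v u ⟨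
    f (λ i → v i + u i) (λ i → v i + u i)  ≈⟨ diag≈0 _ ⟩
    0#                                     ∎)
    where
    c₁≢c₂ : c₁ ≢ c₂
    c₁≢c₂ = adjacent⇒≢ adj
    f : (Fin n → Carrier) → (Fin n → Carrier) → Carrier
    f x y = det R (replaceColumns M c₁ c₂ x y)
    diag≈0 : ∀ w → f w w ≈ 0#
    diag≈0 w = det-adjacentEqualColumns _ adj
      (λ i → reflexive (≡.trans (replaceColumns-at₁ M c₁≢c₂ w w i) (≡.sym (replaceColumns-at₂ M c₁≢c₂ w w i))))
    additiveʳ : ∀ w x y → f w (λ i → x i + y i) ≈ f w x + f w y
    additiveʳ w x y = begin
      f w (λ i → x i + y i)
        ≈⟨ det-cong (λ i j → reflexive (replaceColumn-comm M c₁≢c₂ w _ i j)) ⟩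
      det R (replaceColumn (replaceColumn M c₁ w) c₂ (λ i → x i + y i))
        ≈⟨ det-additive _ c₂ x y ⟩
      det R (replaceColumn (replaceColumn M c₁ w) c₂ x) + det R (replaceColumn (replaceColumn M c₁ w) c₂ y)
        ≈⟨ +-cong (det-cong (λ i j → reflexive (replaceColumn-comm M c₁≢c₂ w x i j)))
                  (det-cong (λ i j → reflexive (replaceColumn-comm M c₁≢c₂ w y i j))) ⟨
      f w x + f w y ∎

  -- Swapping column c₁ with its right neighbour moves the repeated column one step closer to c₂.
  det-equalColumnsAtDistance : ∀ {n d} (M : Mat n) {c₁ c₂} → suc (toℕ c₁) ℕ.+ d ≡ toℕ c₂ →
                               (∀ i → M i c₁ ≈ M i c₂) → det R M ≈ 0#
  det-equalColumnsAtDistance {d = zero} M dist col≈ =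
    det-adjacentEqualColumns M (≡.trans (≡.sym dist) (≡.cong suc (ℕ.+-identityʳ _))) col≈
  det-equalColumnsAtDistance {n} {suc d} M {c₁} {c₂} dist col≈ = begin
    det R M                                                  ≈⟨ det-cong (λ i j → reflexive (replaceColumns-self M c₁≢c⁺ i j)) ⟨
    det R (replaceColumns M c₁ c⁺ (λ i → M i c₁) (λ i → M i c⁺)) ≈⟨ det-replaceColumns-swap M adj _ _ ⟩
    - det R L                                                ≈⟨ -‿cong (det-equalColumnsAtDistance L {c⁺} {c₂} dist′ L-col≈) ⟩
    - 0#                                                     ≈⟨ -0#≈0# ⟩
    0#                                                       ∎
    where
    c₁+1<c₂ : suc (toℕ c₁) < toℕ c₂
    c₁+1<c₂ = ≡.subst (suc (toℕ c₁) <_) dist (≡.subst (suc (toℕ c₁) <_) (≡.sym (ℕ.+-suc _ d)) (s≤s (ℕ.m≤m+n _ d)))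
    c⁺ : Fin n
    c⁺ = Fin.fromℕ< (ℕ.<-trans c₁+1<c₂ (Fin.toℕ<n c₂))
    adj : Adjacent c₁ c⁺
    adj = Fin.toℕ-fromℕ< _
    c₁≢c⁺ : c₁ ≢ c⁺
    c₁≢c⁺ = adjacent⇒≢ adj
    L : Mat n
    L = replaceColumns M c₁ c⁺ (λ i → M i c⁺) (λ i → M i c₁)
    dist′ : suc (toℕ c⁺) ℕ.+ d ≡ toℕ c₂
    dist′ = ≡.trans (≡.cong (λ x → suc x ℕ.+ d) adj) (≡.trans (≡.cong suc (≡.sym (ℕ.+-suc _ d))) dist)
    c₂≢c₁ : c₂ ≢ c₁
    c₂≢c₁ eq = ℕ.<⇒≢ (ℕ.<-trans (ℕ.n<1+n _) c₁+1<c₂) (≡.cong toℕ (≡.sym eq))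
    c₂≢c⁺ : c₂ ≢ c⁺
    c₂≢c⁺ eq = ℕ.<⇒≢ c₁+1<c₂ (≡.trans (≡.sym adj) (≡.cong toℕ (≡.sym eq)))
    L-col≈ : ∀ i → L i c⁺ ≈ L i c₂
    L-col≈ i = begin
      L i c⁺ ≡⟨ replaceColumns-at₂ M c₁≢c⁺ _ _ i ⟩
      M i c₁ ≈⟨ col≈ i ⟩
      M i c₂ ≡⟨ replaceColumns-off M c₁≢c⁺ _ _ i c₂≢c₁ c₂≢c⁺ ⟨
      L i c₂ ∎

  det-equalColumns : ∀ {n} (M : Mat n) {c₁ c₂} → c₁ ≢ c₂ → (∀ i → M i c₁ ≈ M i c₂) → det R M ≈ 0#
  det-equalColumns M {c₁} {c₂} c₁≢c₂ col≈ with ℕ.<-cmp (toℕ c₁) (toℕ c₂)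
  ... | tri< c₁<c₂ _ _ = det-equalColumnsAtDistance M (proj₂ (ℕ.m≤n⇒∃[o]m+o≡n c₁<c₂)) col≈
  ... | tri≈ _ c₁≡c₂ _ = contradiction (Fin.toℕ-injective c₁≡c₂) c₁≢c₂
  ... | tri> _ _ c₂<c₁ = det-equalColumnsAtDistance M (proj₂ (ℕ.m≤n⇒∃[o]m+o≡n c₂<c₁)) (sym ∘ col≈)

  replaceColumn-twice : ∀ {n} (M : Mat n) c u v i j → replaceColumn (replaceColumn M c u) c v i j ≡ replaceColumn M c v i j
  replaceColumn-twice M c u v i j with j Fin.≟ c
  ... | yes _   = ≡.refl
  ... | no  j≢c = replaceColumn-off M c u i j≢c

  det-addColumnMultiples : ∀ K {n} (M : Mat n) c (d : Fin K → Fin n) (α : Fin K → Carrier) → (∀ k → d k ≢ c) →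
    det R (replaceColumn M c (λ i → M i c + Σ.sum (λ k → α k * M i (d k)))) ≈ det R M
  det-addColumnMultiples zero M c d α _ = begin
    det R (replaceColumn M c (λ i → M i c + 0#))  ≈⟨ det-replaceColumn-cong M c (λ i → +-identityʳ _) ⟩
    det R (replaceColumn M c (λ i → M i c))       ≈⟨ det-cong (λ i j → reflexive (replaceColumn-self M c i j)) ⟩
    det R M                                       ∎
  det-addColumnMultiples (suc K) {n} M c d α d≢c = begin
    det R (replaceColumn M c (λ i → M i c + Σ.sum (λ k → α k * M i (d k))))
      ≈⟨ det-replaceColumn-cong M c regroup ⟩
    det R (replaceColumn M c (λ i → M′ i c + Σ.sum (λ k → α (suc k) * M′ i (d (suc k)))))
      ≈⟨ det-cong (λ i j → reflexive (replaceColumn-twice M c _ _ i j)) ⟨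
    det R (replaceColumn M′ c (λ i → M′ i c + Σ.sum (λ k → α (suc k) * M′ i (d (suc k)))))
      ≈⟨ det-addColumnMultiples K M′ c (d ∘ suc) (α ∘ suc) (d≢c ∘ suc) ⟩
    det R M′
      ≈⟨ det-linear M c 1# (α zero) (λ i → M i c) (λ i → M i (d zero)) ⟩
    1# * det R (replaceColumn M c (λ i → M i c)) + α zero * det R (replaceColumn M c (λ i → M i (d zero)))
      ≈⟨ +-cong (trans (*-identityˡ _) (det-cong (λ i j → reflexive (replaceColumn-self M c i j))))
                (trans (*-congˡ repeated≈0) (zeroʳ _)) ⟩
    det R M + 0#
      ≈⟨ +-identityʳ _ ⟩
    det R M ∎
    where
    M′ : Mat n
    M′ = replaceColumn M c (λ i → 1# * M i c + α zero * M i (d zero))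
    regroup : ∀ i → M i c + Σ.sum (λ k → α k * M i (d k)) ≈ M′ i c + Σ.sum (λ k → α (suc k) * M′ i (d (suc k)))
    regroup i = begin
      M i c + (α zero * M i (d zero) + Σ.sum (λ k → α (suc k) * M i (d (suc k))))
        ≈⟨ +-assoc _ _ _ ⟨
      (M i c + α zero * M i (d zero)) + Σ.sum (λ k → α (suc k) * M i (d (suc k)))
        ≈⟨ +-cong (+-congʳ (*-identityˡ _)) (Σ.sum-cong-≋ (λ k → *-congˡ (reflexive (replaceColumn-off M c _ i (d≢c (suc k)))))) ⟨
      (1# * M i c + α zero * M i (d zero)) + Σ.sum (λ k → α (suc k) * M′ i (d (suc k)))
        ≡⟨ ≡.cong (_+ Σ.sum (λ k → α (suc k) * M′ i (d (suc k)))) (replaceColumn-at M c _ i) ⟨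
      M′ i c + Σ.sum (λ k → α (suc k) * M′ i (d (suc k))) ∎
    repeated≈0 : det R (replaceColumn M c (λ i → M i (d zero))) ≈ 0#
    repeated≈0 = det-equalColumns _ (d≢c zero ∘ ≡.sym)
      (λ i → reflexive (≡.trans (replaceColumn-at M c _ i) (≡.sym (replaceColumn-off M c _ i (d≢c zero)))))

  module _ (n : ℕ) {m} (M : Mat (n ℕ.+ m)) (α : Fin n → Fin m → Carrier) where

    private
      added : Fin n → Fin (n ℕ.+ m) → Carrier
      added u i = Σ.sum (λ v → α u v * M i (n ↑ʳ v))

      -- the column operations performed on the left columns u with toℕ u < k only
      partialOps : ℕ → Mat (n ℕ.+ m)
      partialOps k i j = [ (λ u → if does (toℕ u ℕ.<? k) then M i j + added u i else M i j) , (λ _ → M i j) ]′ (splitAt n j)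

      partialOps-left : ∀ k i u → partialOps k i (u ↑ˡ m) ≡ (if does (toℕ u ℕ.<? k) then M i (u ↑ˡ m) + added u i else M i (u ↑ˡ m))
      partialOps-left k i u rewrite Fin.splitAt-↑ˡ n u m = ≡.refl

      partialOps-right : ∀ k i v → partialOps k i (n ↑ʳ v) ≡ M i (n ↑ʳ v)
      partialOps-right k i v rewrite Fin.splitAt-↑ʳ n m v = ≡.refl

      partialOps-done : ∀ {k} i u → toℕ u < k → partialOps k i (u ↑ˡ m) ≡ M i (u ↑ˡ m) + added u i
      partialOps-done {k} i u u<k = ≡.trans (partialOps-left k i u)
        (≡.cong (λ b → if b then M i (u ↑ˡ m) + added u i else M i (u ↑ˡ m)) (dec-true (toℕ u ℕ.<? k) u<k))

      partialOps-todo : ∀ {k} i u → ¬ toℕ u < k → partialOps k i (u ↑ˡ m) ≡ M i (u ↑ˡ m)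
      partialOps-todo {k} i u u≮k = ≡.trans (partialOps-left k i u)
        (≡.cong (λ b → if b then M i (u ↑ˡ m) + added u i else M i (u ↑ˡ m)) (dec-false (toℕ u ℕ.<? k) u≮k))

      partialOps-step : ∀ {k} (k<n : k < n) → let c = Fin.fromℕ< k<n ↑ˡ m in ∀ i j →
        partialOps (suc k) i j
          ≈ replaceColumn (partialOps k) c (λ i → partialOps k i c + Σ.sum (λ v → α (Fin.fromℕ< k<n) v * partialOps k i (n ↑ʳ v))) i j
      partialOps-step {k} k<n i j with splitView n j
      ... | right v = reflexive (≡.trans (partialOps-right (suc k) i v)
                        (≡.sym (≡.trans (replaceColumn-off _ _ _ i (↑ˡ≢↑ʳ _ v ∘ ≡.sym)) (partialOps-right k i v))))
      ... | left  u with u Fin.≟ Fin.fromℕ< k<n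
      ...   | yes ≡.refl = begin
        partialOps (suc k) i (u ↑ˡ m)   ≡⟨ partialOps-done i u (≡.subst (_< suc k) (≡.sym u≡k) (ℕ.n<1+n k)) ⟩
        M i (u ↑ˡ m) + added u i         ≈⟨ +-cong (reflexive (≡.sym (partialOps-todo i u (ℕ.<-irrefl u≡k))))
                                                  (Σ.sum-cong-≋ (λ v → *-congˡ (reflexive (≡.sym (partialOps-right k i v))))) ⟩
        partialOps k i (u ↑ˡ m) + Σ.sum (λ v → α u v * partialOps k i (n ↑ʳ v))
                                         ≡⟨ replaceColumn-at (partialOps k) (u ↑ˡ m) _ i ⟨
        _                                ∎
        where
        u≡k : toℕ u ≡ k
        u≡k = Fin.toℕ-fromℕ< k<n
      ...   | no u≢u₀ = reflexive (≡.trans (sameStatus (toℕ u ℕ.<? k))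
                          (≡.sym (replaceColumn-off _ _ _ i (u≢u₀ ∘ Fin.↑ˡ-injective m u _))))
        where
        sameStatus : Dec (toℕ u < k) → partialOps (suc k) i (u ↑ˡ m) ≡ partialOps k i (u ↑ˡ m)
        sameStatus (yes u<k) = ≡.trans (partialOps-done i u (ℕ.m<n⇒m<1+n u<k)) (≡.sym (partialOps-done i u u<k))
        sameStatus (no  u≮k) = ≡.trans (partialOps-todo i u u≮1+k) (≡.sym (partialOps-todo i u u≮k))
          where
          u≮1+k : ¬ toℕ u < suc k
          u≮1+k u<1+k = u≢u₀ (Fin.toℕ-injective
            (≡.trans (ℕ.≤-antisym (ℕ.s≤s⁻¹ u<1+k) (ℕ.≮⇒≥ u≮k)) (≡.sym (Fin.toℕ-fromℕ< k<n))))

      det-partialOps : ∀ k → k ≤ n → det R (partialOps k) ≈ det R M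
      det-partialOps zero    _   = det-cong entry≈
        where
        entry≈ : ∀ i j → partialOps zero i j ≈ M i j
        entry≈ i j with splitView n j
        ... | left  u = reflexive (partialOps-todo {zero} i u (λ ()))
        ... | right v = reflexive (partialOps-right zero i v)
      det-partialOps (suc k) k<n = begin
        det R (partialOps (suc k))  ≈⟨ det-cong (partialOps-step k<n) ⟩
        det R (replaceColumn (partialOps k) (u₀ ↑ˡ m)
                 (λ i → partialOps k i (u₀ ↑ˡ m) + Σ.sum (λ v → α u₀ v * partialOps k i (n ↑ʳ v))))
          ≈⟨ det-addColumnMultiples m (partialOps k) (u₀ ↑ˡ m) (n ↑ʳ_) (α u₀) (λ v → ↑ˡ≢↑ʳ u₀ v ∘ ≡.sym) ⟩
        det R (partialOps k)        ≈⟨ det-partialOps k (ℕ.<⇒≤ k<n) ⟩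
        det R M                     ∎
        where
        u₀ : Fin n
        u₀ = Fin.fromℕ< k<n

    det-addRightColumnsToLeft : (L : Mat (n ℕ.+ m)) →
      (∀ i u → L i (u ↑ˡ m) ≈ M i (u ↑ˡ m) + added u i) → (∀ i v → L i (n ↑ʳ v) ≈ M i (n ↑ʳ v)) →
      det R L ≈ det R M
    det-addRightColumnsToLeft L L-left L-right = trans (det-cong entry≈) (det-partialOps n ℕ.≤-refl)
      where
      entry≈ : ∀ i j → L i j ≈ partialOps n i j
      entry≈ i j with splitView n j
      ... | left  u = trans (L-left i u) (reflexive (≡.sym (partialOps-done i u (Fin.toℕ<n u))))
      ... | right v = trans (L-right i v) (reflexive (≡.sym (partialOps-right n i v)))

  -- Block matrices

  toℕ-punchIn-≤ : ∀ {n} (i : Fin (suc n)) (j : Fin n) → toℕ (punchIn i j) ≤ suc (toℕ j)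
  toℕ-punchIn-≤ zero    j       = ℕ.≤-refl
  toℕ-punchIn-≤ (suc i) zero    = z≤n
  toℕ-punchIn-≤ (suc i) (suc j) = s≤s (toℕ-punchIn-≤ i j)

  punchIn-below : ∀ {n b} (j : Fin (suc n)) (c : Fin n) → toℕ c < b → b ≤ toℕ j → toℕ (punchIn j c) < b
  punchIn-below j c c<b b≤j = ≡.subst (_< _) (≡.sym (toℕ-punchIn-< j c (ℕ.<-≤-trans c<b b≤j))) c<b

  -- The rows from a on vanish on the first b columns: N ∸ a rows live in N ∸ b < N ∸ a dimensions.
  det-zeroBlock : ∀ {N} (M : Mat N) a b → a < b → a < N →
                  (∀ i j → a ≤ toℕ i → toℕ j < b → M i j ≈ 0#) → det R M ≈ 0#
  det-zeroBlock {suc N} M zero b 0<b _ block≈0 = trans (det-expand M) (Σ.sum-zero term≈0)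
    where
    term≈0 : ∀ j → expansionTerm M j ≈ 0#
    term≈0 j with toℕ j ℕ.<? b
    ... | yes j<b = expansionTerm-entry≈0 M j (block≈0 zero j z≤n j<b)
    ... | no  j≮b = expansionTerm-minor≈0 M j (det-zeroBlock (minor M j) zero b 0<b 0<N
                      (λ i c _ c<b → block≈0 (suc i) (punchIn j c) z≤n (punchIn-below j c c<b b≤j)))
      where
      b≤j : b ≤ toℕ j
      b≤j = ℕ.≮⇒≥ j≮b
      0<N : 0 < N
      0<N = ℕ.<-≤-trans 0<b (ℕ.≤-trans b≤j (ℕ.s≤s⁻¹ (Fin.toℕ<n j)))
  det-zeroBlock {suc N} M (suc a) (suc b) (s≤s a<b) (s≤s a<N) block≈0 = trans (det-expand M) (Σ.sum-zero term≈0)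
    where
    term≈0 : ∀ j → expansionTerm M j ≈ 0#
    term≈0 j with toℕ j ℕ.<? suc b
    ... | yes _   = expansionTerm-minor≈0 M j (det-zeroBlock (minor M j) a b a<b a<N
                      (λ i c a≤i c<b → block≈0 (suc i) (punchIn j c) (s≤s a≤i) (ℕ.≤-<-trans (toℕ-punchIn-≤ j c) (s≤s c<b))))
    ... | no  j≮b = expansionTerm-minor≈0 M j (det-zeroBlock (minor M j) a (suc b) (ℕ.m<n⇒m<1+n a<b) a<N
                      (λ i c a≤i c<b → block≈0 (suc i) (punchIn j c) (s≤s a≤i) (punchIn-below j c c<b (ℕ.≮⇒≥ j≮b))))

  punchIn-↑ˡ : ∀ {a} b (k : Fin (suc a)) (j : Fin a) → punchIn (k ↑ˡ b) (j ↑ˡ b) ≡ punchIn k j ↑ˡ b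
  punchIn-↑ˡ b zero    j       = ≡.refl
  punchIn-↑ˡ b (suc k) zero    = ≡.refl
  punchIn-↑ˡ b (suc k) (suc j) = ≡.cong suc (punchIn-↑ˡ b k j)

  punchIn-↑ʳ : ∀ a {b} (k : Fin (suc a)) (j : Fin b) → punchIn (k ↑ˡ b) (a ↑ʳ j) ≡ suc a ↑ʳ j
  punchIn-↑ʳ a       zero    j = ≡.refl
  punchIn-↑ʳ (suc a) (suc k) j = ≡.cong suc (punchIn-↑ʳ a k j)

  det-blockTriangular : ∀ a {b} (M : Mat (a ℕ.+ b)) → (∀ i j → M (a ↑ʳ i) (j ↑ˡ b) ≈ 0#) →
    det R M ≈ det R (λ i j → M (i ↑ˡ b) (j ↑ˡ b)) * det R (λ i j → M (a ↑ʳ i) (a ↑ʳ j))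
  det-blockTriangular zero    M _ = sym (*-identityˡ _)
  det-blockTriangular (suc a) {b} M block≈0 = begin
    det R M                                                   ≈⟨ det-expand M ⟩
    Σ.sum (expansionTerm M)                                   ≈⟨ Σ.sum-↑ (suc a) (expansionTerm M) ⟩
    Σ.sum (λ k → expansionTerm M (k ↑ˡ b)) + Σ.sum (λ l → expansionTerm M (suc a ↑ʳ l))
                                                              ≈⟨ +-cong (Σ.sum-cong-≋ leftTerm) (Σ.sum-zero rightTerm≈0) ⟩
    Σ.sum (λ k → expansionTerm P k * det R D) + 0#            ≈⟨ +-identityʳ _ ⟩
    Σ.sum (λ k → expansionTerm P k * det R D)                 ≈⟨ *-distribʳ-sum (det R D) (expansionTerm P) ⟨
    Σ.sum (expansionTerm P) * det R D                         ≈⟨ *-congʳ (det-expand P) ⟨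
    det R P * det R D                                         ∎
    where
    P : Mat (suc a)
    P i j = M (i ↑ˡ b) (j ↑ˡ b)
    D : Mat b
    D i j = M (suc a ↑ʳ i) (suc a ↑ʳ j)
    leftTerm : ∀ k → expansionTerm M (k ↑ˡ b) ≈ expansionTerm P k * det R D
    leftTerm k = begin
      sgn R (toℕ (k ↑ˡ b)) * (P zero k * det R (minor M (k ↑ˡ b)))
        ≡⟨ ≡.cong (λ s → sgn R s * (P zero k * det R (minor M (k ↑ˡ b)))) (Fin.toℕ-↑ˡ k b) ⟩
      sgn R (toℕ k) * (P zero k * det R (minor M (k ↑ˡ b)))
        ≈⟨ *-congˡ (*-congˡ minor≈) ⟩
      sgn R (toℕ k) * (P zero k * (det R (minor P k) * det R D))
        ≈⟨ solve 4 (λ s x y d → s :* (x :* (y :* d)) := (s :* (x :* y)) :* d) refl _ _ _ _ ⟩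
      expansionTerm P k * det R D ∎
      where
      minor≈ : det R (minor M (k ↑ˡ b)) ≈ det R (minor P k) * det R D
      minor≈ = trans
        (det-blockTriangular a (minor M (k ↑ˡ b))
          (λ i j → ≡.subst (λ x → M (suc a ↑ʳ i) x ≈ 0#) (≡.sym (punchIn-↑ˡ b k j)) (block≈0 i (punchIn k j))))
        (*-cong (det-cong (λ i j → reflexive (≡.cong (M (suc i ↑ˡ b)) (punchIn-↑ˡ b k j))))
                (det-cong (λ i j → reflexive (≡.cong (M (suc a ↑ʳ i)) (punchIn-↑ʳ a k j)))))
    lowerLeft≈0 : ∀ i j → suc a ≤ toℕ i → toℕ j < suc a → M i j ≈ 0#
    lowerLeft≈0 i j a<i j<a with splitView (suc a) i | splitView (suc a) j
    ... | left u  | _       = contradiction (≡.subst (_< suc a) (≡.sym (Fin.toℕ-↑ˡ u b)) (Fin.toℕ<n u)) (ℕ.≤⇒≯ a<i)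
    ... | _       | right v = contradiction (≡.subst (suc a ≤_) (≡.sym (Fin.toℕ-↑ʳ (suc a) v)) (ℕ.m≤m+n (suc a) (toℕ v))) (ℕ.<⇒≱ j<a)
    ... | right u | left v  = block≈0 u v
    rightTerm≈0 : ∀ l → expansionTerm M (suc a ↑ʳ l) ≈ 0#
    rightTerm≈0 l = expansionTerm-minor≈0 M (suc a ↑ʳ l)
      (det-zeroBlock (minor M (suc a ↑ʳ l)) a (suc a) (ℕ.n<1+n a) (ℕ.m<m+n a (ℕ.≤-<-trans z≤n (Fin.toℕ<n l)))
        (λ i j a≤i j<a → lowerLeft≈0 (suc i) (punchIn (suc a ↑ʳ l) j) (s≤s a≤i)
          (punchIn-below (suc a ↑ʳ l) j j<a (≡.subst (suc a ≤_) (≡.sym (Fin.toℕ-↑ʳ (suc a) l)) (ℕ.m≤m+n (suc a) (toℕ l))))))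

  det-blockDiagonal : ∀ t {m} (M : Mat (t ℕ.* m)) (Y : Fin t → Mat m) →
    (∀ (g g′ : Fin t) (w w′ : Fin m) → g ≢ g′ → M (combine g w) (combine g′ w′) ≈ 0#) →
    (∀ (g : Fin t) (w w′ : Fin m) → M (combine g w) (combine g w′) ≈ Y g w w′) →
    det R M ≈ Π.sum (λ g → det R (Y g))
  det-blockDiagonal zero    M Y _ _ = refl
  det-blockDiagonal (suc t) {m} M Y offDiagonal≈0 diagonal≈ = begin
    det R M
      ≈⟨ det-blockTriangular m M lowerLeft≈0 ⟩
    det R (λ i j → M (i ↑ˡ t ℕ.* m) (j ↑ˡ t ℕ.* m)) * det R (λ i j → M (m ↑ʳ i) (m ↑ʳ j))
      ≈⟨ *-cong (det-cong (diagonal≈ zero))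
                (det-blockDiagonal t {m} (λ i j → M (m ↑ʳ i) (m ↑ʳ j)) (Y ∘ suc)
                   (λ g g′ w w′ g≢g′ → offDiagonal≈0 (suc g) (suc g′) w w′ (g≢g′ ∘ Fin.suc-injective))
                   (λ g → diagonal≈ (suc g))) ⟩
    Π.sum (λ g → det R (Y g)) ∎
    where
    lowerLeft≈0 : ∀ i j → M (m ↑ʳ i) (j ↑ˡ t ℕ.* m) ≈ 0#
    lowerLeft≈0 i j = combine-elim {n = t} {m} {P = λ x → M (m ↑ʳ x) (j ↑ˡ t ℕ.* m) ≈ 0#}
      (λ g w → offDiagonal≈0 (suc g) zero w j (λ ())) i

module Indicator where

  open import Data.Bool.Base using (if_then_else_)
  open import Data.Nat.Base using (ℕ)
  open import Relation.Binary.PropositionalEquality using (_≡_; cong)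
  open import Relation.Nullary using (¬_; Dec; does)
  open import Relation.Nullary.Decidable using (dec-true; dec-false)

  -- defined through `does` so that it computes along Dec.map′
  indicator : ∀ {P : Set} → Dec P → ℕ
  indicator P? = if does P? then 1 else 0

  indicator-yes : ∀ {P : Set} (P? : Dec P) → P → indicator P? ≡ 1
  indicator-yes P? p = cong (if_then 1 else 0) (dec-true P? p)

  indicator-no : ∀ {P : Set} (P? : Dec P) → ¬ P → indicator P? ≡ 0
  indicator-no P? ¬p = cong (if_then 1 else 0) (dec-false P? ¬p)

module ListCounting {A : Set} where

  open import Data.Nat.Base using (suc; _+_)
  open import Data.Nat.Properties using (+-suc)
  open import Data.Fin.Base using (Fin)
  open import Data.List.Base using (List; []; _∷_; length; filter)
  open import Data.List.Membership.Propositional using (_∈_)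
  open import Data.List.Membership.Propositional.Properties.WithK using (unique∧set⇒bag)
  open import Data.List.Relation.Binary.BagAndSetEquality using (∼bag⇒↭)
  open import Data.List.Relation.Binary.Permutation.Propositional.Properties using (↭-length)
  open import Data.List.Relation.Unary.Any using (here; there)
  open import Data.List.Relation.Unary.Unique.Propositional using (Unique)
  open import Data.Empty using (⊥; ⊥-elim)
  open import Data.Product using (∃; proj₁; proj₂)
  open import Function.Base using (_∘_)
  open import Function.Bundles using (_⇔_)
  open import Level using (0ℓ)
  open import Relation.Binary.PropositionalEquality using (_≡_; refl; cong; trans; sym; module ≡-Reasoning)
  open import Relation.Nullary using (yes; no)
  open import Relation.Nullary.Decidable using (¬?)
  open import Relation.Unary using (Pred; Decidable)
  open Indicator

  unique∧set⇒length≡ : ∀ {xs ys : List A} → Unique xs → Unique ys → (∀ {z} → z ∈ xs ⇔ z ∈ ys) →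
                       length xs ≡ length ys
  unique∧set⇒length≡ uxs uys same = ↭-length (∼bag⇒↭ (unique∧set⇒bag uxs uys same))

  length-noMembers : ∀ {xs : List A} → (∀ {z} → z ∈ xs → ⊥) → length xs ≡ 0
  length-noMembers {[]}    _         = refl
  length-noMembers {x ∷ _} noMember = ⊥-elim (noMember (here refl))

  length-partition : ∀ {P : Pred A 0ℓ} (P? : Decidable P) xs →
                     length xs ≡ length (filter P? xs) + length (filter (¬? ∘ P?) xs)
  length-partition P? []       = refl
  length-partition P? (x ∷ xs) with P? x
  ... | yes _ = cong suc (length-partition P? xs)
  ... | no  _ = trans (cong suc (length-partition P? xs)) (sym (+-suc _ _))

  length-filter-∷ : ∀ {P : Pred A 0ℓ} (P? : Decidable P) x xs →
                   length (filter P? (x ∷ xs)) ≡ indicator (P? x) + length (filter P? xs)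
  length-filter-∷ P? x xs with P? x
  ... | yes _ = refl
  ... | no  _ = refl

  length-classes : ∀ {p} {Q : Fin p → Pred A 0ℓ} (Q? : ∀ j → Decidable (Q j)) xs →
                   (∀ {z} → z ∈ xs → ∃ λ j → Q j z) → (∀ {z j j′} → z ∈ xs → Q j z → Q j′ z → j ≡ j′) →
                   length xs ≡ ℕΣ.sum (λ j → length (filter (Q? j) xs))
  length-classes {p} Q? [] _ _ = sym (ℕΣ.sum-zero {p} (λ _ → refl))
  length-classes {p} Q? (x ∷ xs) classOf unique = begin
    suc (length xs)
      ≡⟨ cong suc (length-classes Q? xs (classOf ∘ there) (unique ∘ there)) ⟩
    suc (ℕΣ.sum (λ j → length (filter (Q? j) xs)))
      ≡⟨ cong (_+ ℕΣ.sum (λ j → length (filter (Q? j) xs))) oneClass ⟨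
    ℕΣ.sum (λ j → indicator (Q? j x)) + ℕΣ.sum (λ j → length (filter (Q? j) xs))
      ≡⟨ ℕΣ.∑-distrib-+ (λ j → indicator (Q? j x)) (λ j → length (filter (Q? j) xs)) ⟨
    ℕΣ.sum (λ j → indicator (Q? j x) + length (filter (Q? j) xs))
      ≡⟨ ℕΣ.sum-cong-≋ (λ j → length-filter-∷ (Q? j) x xs) ⟨
    ℕΣ.sum (λ j → length (filter (Q? j) (x ∷ xs))) ∎
    where
    open ≡-Reasoning
    c : Fin p
    c = proj₁ (classOf (here refl))
    oneClass : ℕΣ.sum (λ j → indicator (Q? j x)) ≡ 1
    oneClass = trans (ℕΣ.sum-single c (λ j j≢c → indicator-no (Q? j x) (λ q → j≢c (unique (here refl) q (proj₂ (classOf (here refl)))))))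
                     (indicator-yes (Q? c x) (proj₂ (classOf (here refl))))

module SubsetsBetween where

  open import Data.Nat.Base using (ℕ; zero; suc; _+_; _∸_; _≤_; _<_; s≤s)
  import Data.Nat.Properties as ℕ
  open import Data.Fin.Base using (Fin; zero; suc)
  open import Data.Fin.Subset using (Subset; inside; outside; _⊆_; ∣_∣; ⁅_⁆; _∪_) renaming (_∈_ to _∈ₛ_)
  open import Function.Base using (_∘_)
  open import Data.Fin.Subset.Properties
  open import Data.Vec.Base as Vec using ([]; _∷_)
  open import Data.List.Base using (List; []; _∷_; [_]; length; map; _++_; filter)
  open import Data.List.Properties using (length-map; length-++)
  open import Data.List.Membership.Propositional using (_∈_)
  open import Data.List.Membership.Propositional.Properties using (∈-map⁺; ∈-map⁻; ∈-++⁺ˡ; ∈-++⁺ʳ; ∈-++⁻; ∈-filter⁺; ∈-filter⁻)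
  open import Relation.Nullary.Decidable using (¬?)
  open import Data.List.Relation.Unary.Any using (here)
  open import Data.List.Relation.Unary.Unique.Propositional using (Unique)
  import Data.List.Relation.Unary.Unique.Propositional.Properties as Unique
  open import Data.Product using (_×_; _,_; proj₂)
  open import Data.Empty using (⊥)
  open import Data.Vec.Properties using (∷-injectiveʳ)
  import Data.List.Relation.Unary.All as All
  import Data.List.Relation.Unary.AllPairs as AllPairs
  open import Data.Sum using (inj₁; inj₂)
  open import Relation.Binary.PropositionalEquality using (_≡_; _≢_; refl; cong; cong₂; sym; trans; subst; module ≡-Reasoning)
  open import Relation.Nullary using (Dec; yes; no; contradiction)
  open import Function.Bundles using (mk⇔)
  open ≡-Reasoning
  open ListCounting using (unique∧set⇒length≡; length-partition)

  -- the sets e with A ⊆ e ⊆ B and ∣ e ∣ ≡ k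
  subsetsBetween : ∀ {N} → Subset N → Subset N → ℕ → List (Subset N)
  subsetsBetween []            []            zero    = [ [] ]
  subsetsBetween []            []            (suc k) = []
  subsetsBetween (inside  ∷ A) (inside  ∷ B) zero    = []
  subsetsBetween (inside  ∷ A) (inside  ∷ B) (suc k) = map (inside ∷_) (subsetsBetween A B k)
  subsetsBetween (inside  ∷ A) (outside ∷ B) k       = []
  subsetsBetween (outside ∷ A) (inside  ∷ B) zero    = map (outside ∷_) (subsetsBetween A B zero)
  subsetsBetween (outside ∷ A) (inside  ∷ B) (suc k) =
    map (inside ∷_) (subsetsBetween A B k) ++ map (outside ∷_) (subsetsBetween A B (suc k))
  subsetsBetween (outside ∷ A) (outside ∷ B) k       = map (outside ∷_) (subsetsBetween A B k)

  ∈-subsetsBetween⁻ : ∀ {N} (A B : Subset N) k {e} → e ∈ subsetsBetween A B k → A ⊆ e × e ⊆ B × ∣ e ∣ ≡ k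
  ∈-subsetsBetween⁻ []            []            zero    (here refl) = (λ ()) , (λ ()) , refl
  ∈-subsetsBetween⁻ (inside  ∷ A) (inside  ∷ B) (suc k) e∈ with ∈-map⁻ (inside ∷_) e∈
  ... | _ , e∈′ , refl with ∈-subsetsBetween⁻ A B k e∈′
  ...   | A⊆e , e⊆B , size = in⊆in A⊆e , in⊆in e⊆B , cong suc size
  ∈-subsetsBetween⁻ (outside ∷ A) (inside  ∷ B) zero    e∈ with ∈-map⁻ (outside ∷_) e∈
  ... | _ , e∈′ , refl with ∈-subsetsBetween⁻ A B zero e∈′
  ...   | A⊆e , e⊆B , size = out⊆ A⊆e , out⊆ e⊆B , size
  ∈-subsetsBetween⁻ (outside ∷ A) (inside  ∷ B) (suc k) e∈ with ∈-++⁻ (map (inside ∷_) (subsetsBetween A B k)) e∈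
  ... | inj₁ e∈ˡ with ∈-map⁻ (inside ∷_) e∈ˡ
  ...   | _ , e∈′ , refl with ∈-subsetsBetween⁻ A B k e∈′
  ...     | A⊆e , e⊆B , size = out⊆ A⊆e , in⊆in e⊆B , cong suc size
  ∈-subsetsBetween⁻ (outside ∷ A) (inside  ∷ B) (suc k) e∈ | inj₂ e∈ʳ with ∈-map⁻ (outside ∷_) e∈ʳ
  ...   | _ , e∈′ , refl with ∈-subsetsBetween⁻ A B (suc k) e∈′
  ...     | A⊆e , e⊆B , size = out⊆ A⊆e , out⊆ e⊆B , size
  ∈-subsetsBetween⁻ (outside ∷ A) (outside ∷ B) k       e∈ with ∈-map⁻ (outside ∷_) e∈
  ... | _ , e∈′ , refl with ∈-subsetsBetween⁻ A B k e∈′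
  ...   | A⊆e , e⊆B , size = out⊆ A⊆e , out⊆ e⊆B , size

  ∈-subsetsBetween⁺ : ∀ {N} (A B : Subset N) k {e} → A ⊆ e → e ⊆ B → ∣ e ∣ ≡ k → e ∈ subsetsBetween A B k
  ∈-subsetsBetween⁺ []            []            zero    {[]}          _   _   _    = here refl
  ∈-subsetsBetween⁺ (inside  ∷ A) _             _       {outside ∷ e} A⊆e _   _    = contradiction (A⊆e Vec.here) λ ()
  ∈-subsetsBetween⁺ _             (outside ∷ B) _       {inside  ∷ e} _   e⊆B _    = contradiction (e⊆B Vec.here) λ ()
  ∈-subsetsBetween⁺ (inside  ∷ A) (inside  ∷ B) (suc k) {inside  ∷ e} A⊆e e⊆B size =
    ∈-map⁺ (inside ∷_) (∈-subsetsBetween⁺ A B k (drop-∷-⊆ A⊆e) (drop-∷-⊆ e⊆B) (ℕ.suc-injective size))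
  ∈-subsetsBetween⁺ (outside ∷ A) (inside  ∷ B) (suc k) {inside  ∷ e} A⊆e e⊆B size =
    ∈-++⁺ˡ (∈-map⁺ (inside ∷_) (∈-subsetsBetween⁺ A B k (drop-∷-⊆ A⊆e) (drop-∷-⊆ e⊆B) (ℕ.suc-injective size)))
  ∈-subsetsBetween⁺ (outside ∷ A) (inside  ∷ B) zero    {outside ∷ e} A⊆e e⊆B size =
    ∈-map⁺ (outside ∷_) (∈-subsetsBetween⁺ A B zero (drop-∷-⊆ A⊆e) (drop-∷-⊆ e⊆B) size)
  ∈-subsetsBetween⁺ (outside ∷ A) (inside  ∷ B) (suc k) {outside ∷ e} A⊆e e⊆B size =
    ∈-++⁺ʳ (map (inside ∷_) (subsetsBetween A B k))
           (∈-map⁺ (outside ∷_) (∈-subsetsBetween⁺ A B (suc k) (drop-∷-⊆ A⊆e) (drop-∷-⊆ e⊆B) size))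
  ∈-subsetsBetween⁺ (outside ∷ A) (outside ∷ B) k       {outside ∷ e} A⊆e e⊆B size =
    ∈-map⁺ (outside ∷_) (∈-subsetsBetween⁺ A B k (drop-∷-⊆ A⊆e) (drop-∷-⊆ e⊆B) size)

  subsetsBetween-unique : ∀ {N} (A B : Subset N) k → Unique (subsetsBetween A B k)
  subsetsBetween-unique []            []            zero    = All.[] AllPairs.∷ AllPairs.[]
  subsetsBetween-unique []            []            (suc k) = AllPairs.[]
  subsetsBetween-unique (inside  ∷ A) (inside  ∷ B) zero    = AllPairs.[]
  subsetsBetween-unique (inside  ∷ A) (inside  ∷ B) (suc k) = Unique.map⁺ ∷-injectiveʳ (subsetsBetween-unique A B k)
  subsetsBetween-unique (inside  ∷ A) (outside ∷ B) k       = AllPairs.[]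
  subsetsBetween-unique (outside ∷ A) (inside  ∷ B) zero    = Unique.map⁺ ∷-injectiveʳ (subsetsBetween-unique A B zero)
  subsetsBetween-unique (outside ∷ A) (inside  ∷ B) (suc k) =
    Unique.++⁺ (Unique.map⁺ ∷-injectiveʳ (subsetsBetween-unique A B k))
               (Unique.map⁺ ∷-injectiveʳ (subsetsBetween-unique A B (suc k)))
               λ (e∈ˡ , e∈ʳ) → headsDiffer (proj₂ (proj₂ (∈-map⁻ (inside ∷_) e∈ˡ))) (proj₂ (proj₂ (∈-map⁻ (outside ∷_) e∈ʳ)))
    where
    headsDiffer : ∀ {n} {e : Subset (suc n)} {e′ e″} → e ≡ inside ∷ e′ → e ≡ outside ∷ e″ → ⊥
    headsDiffer refl ()
  subsetsBetween-unique (outside ∷ A) (outside ∷ B) k       = Unique.map⁺ ∷-injectiveʳ (subsetsBetween-unique A B k)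

  length-subsetsBetween-tooSmall : ∀ {N} (A B : Subset N) k → k < ∣ A ∣ → length (subsetsBetween A B k) ≡ 0
  length-subsetsBetween-tooSmall A B k k<∣A∣ =
    unique∧set⇒length≡ (subsetsBetween-unique A B k) AllPairs.[] (mk⇔ noMember λ ())
    where
    noMember : ∀ {e} → e ∈ subsetsBetween A B k → e ∈ []
    noMember e∈ with ∈-subsetsBetween⁻ A B k e∈
    ... | A⊆e , _ , refl = contradiction (p⊆q⇒∣p∣≤∣q∣ A⊆e) (ℕ.<⇒≱ k<∣A∣)

  length-subsetsBetween : ∀ {N} (A B : Subset N) k → A ⊆ B → ∣ A ∣ ≤ k →
                          length (subsetsBetween A B k) ≡ choose (∣ B ∣ ∸ ∣ A ∣) (k ∸ ∣ A ∣)
  length-subsetsBetween []            []            zero    _   _ = refl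
  length-subsetsBetween []            []            (suc k) _   _ = refl
  length-subsetsBetween (inside  ∷ A) (outside ∷ B) _       A⊆B _ = contradiction (A⊆B Vec.here) λ ()
  length-subsetsBetween (inside  ∷ A) (inside  ∷ B) (suc k) A⊆B (s≤s ∣A∣≤k) =
    trans (length-map (inside ∷_) (subsetsBetween A B k)) (length-subsetsBetween A B k (drop-∷-⊆ A⊆B) ∣A∣≤k)
  length-subsetsBetween (outside ∷ A) (outside ∷ B) k       A⊆B ∣A∣≤k =
    trans (length-map (outside ∷_) (subsetsBetween A B k)) (length-subsetsBetween A B k (drop-∷-⊆ A⊆B) ∣A∣≤k)
  length-subsetsBetween (outside ∷ A) (inside  ∷ B) zero    A⊆B ∣A∣≤0 = begin
    length (map (outside ∷_) (subsetsBetween A B zero))  ≡⟨ length-map (outside ∷_) (subsetsBetween A B zero) ⟩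
    length (subsetsBetween A B zero)                     ≡⟨ length-subsetsBetween A B zero (drop-∷-⊆ A⊆B) ∣A∣≤0 ⟩
    choose (∣ B ∣ ∸ ∣ A ∣) (0 ∸ ∣ A ∣)                   ≡⟨ cong (choose _) (ℕ.0∸n≡0 ∣ A ∣) ⟩
    1                                                    ≡⟨ cong (choose _) (ℕ.0∸n≡0 ∣ A ∣) ⟨
    choose (suc ∣ B ∣ ∸ ∣ A ∣) (0 ∸ ∣ A ∣)               ∎
  length-subsetsBetween (outside ∷ A) (inside  ∷ B) (suc k) A⊆B ∣A∣≤1+k = begin
    length (map (inside ∷_) (subsetsBetween A B k) ++ map (outside ∷_) (subsetsBetween A B (suc k)))
      ≡⟨ length-++ (map (inside ∷_) (subsetsBetween A B k)) ⟩
    length (map (inside ∷_) (subsetsBetween A B k)) + length (map (outside ∷_) (subsetsBetween A B (suc k)))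
      ≡⟨ cong₂ _+_ (length-map (inside ∷_) (subsetsBetween A B k))
                   (trans (length-map (outside ∷_) (subsetsBetween A B (suc k))) (length-subsetsBetween A B (suc k) A⊆B′ ∣A∣≤1+k)) ⟩
    length (subsetsBetween A B k) + choose (∣ B ∣ ∸ ∣ A ∣) (suc k ∸ ∣ A ∣)
      ≡⟨ pascal (∣ A ∣ ℕ.≤? k) ⟩
    choose (suc ∣ B ∣ ∸ ∣ A ∣) (suc k ∸ ∣ A ∣) ∎
    where
    A⊆B′ : A ⊆ B
    A⊆B′ = drop-∷-⊆ A⊆B
    suc-∸ : ∀ {m n} → n ≤ m → suc m ∸ n ≡ suc (m ∸ n)
    suc-∸ = ℕ.+-∸-assoc 1
    pascal : Dec (∣ A ∣ ≤ k) →
             length (subsetsBetween A B k) + choose (∣ B ∣ ∸ ∣ A ∣) (suc k ∸ ∣ A ∣) ≡ choose (suc ∣ B ∣ ∸ ∣ A ∣) (suc k ∸ ∣ A ∣)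
    pascal (yes ∣A∣≤k) rewrite length-subsetsBetween A B k A⊆B′ ∣A∣≤k | suc-∸ ∣A∣≤k | suc-∸ (p⊆q⇒∣p∣≤∣q∣ A⊆B′) = refl
    pascal (no ∣A∣≰k) rewrite length-subsetsBetween-tooSmall A B k (ℕ.≰⇒> ∣A∣≰k) | ℕ.m≤n⇒m∸n≡0 (ℕ.≰⇒> ∣A∣≰k) = refl

  ⁅x⁆∪⁅y⁆⊆ : ∀ {N} {x y : Fin N} {e} → x ∈ₛ e → y ∈ₛ e → ⁅ x ⁆ ∪ ⁅ y ⁆ ⊆ e
  ⁅x⁆∪⁅y⁆⊆ {x = x} {y} x∈e y∈e z∈ with x∈p∪q⁻ ⁅ x ⁆ ⁅ y ⁆ z∈
  ... | inj₁ z∈⁅x⁆ rewrite x∈⁅y⁆⇒x≡y x z∈⁅x⁆ = x∈e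
  ... | inj₂ z∈⁅y⁆ rewrite x∈⁅y⁆⇒x≡y y z∈⁅y⁆ = y∈e

  ⁅x⁆∪⁅y⁆⊆⁻ : ∀ {N} {x y : Fin N} {e} → ⁅ x ⁆ ∪ ⁅ y ⁆ ⊆ e → x ∈ₛ e × y ∈ₛ e
  ⁅x⁆∪⁅y⁆⊆⁻ {x = x} {y} ⊆e = ⊆e (x∈p∪q⁺ (inj₁ (x∈⁅x⁆ x))) , ⊆e (x∈p∪q⁺ (inj₂ (x∈⁅x⁆ y)))

  ∣⁅x⁆∪⁅y⁆∣≡2 : ∀ {N} {x y : Fin N} → x ≢ y → ∣ ⁅ x ⁆ ∪ ⁅ y ⁆ ∣ ≡ 2
  ∣⁅x⁆∪⁅y⁆∣≡2 {x = zero}  {zero}  x≢y = contradiction refl x≢y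
  ∣⁅x⁆∪⁅y⁆∣≡2 {x = zero}  {suc y} _   = cong suc (trans (cong ∣_∣ (∪-identityˡ ⁅ y ⁆)) (∣⁅x⁆∣≡1 y))
  ∣⁅x⁆∪⁅y⁆∣≡2 {x = suc x} {zero}  _   = cong suc (trans (cong ∣_∣ (∪-identityʳ ⁅ x ⁆)) (∣⁅x⁆∣≡1 x))
  ∣⁅x⁆∪⁅y⁆∣≡2 {x = suc x} {suc y} x≢y = ∣⁅x⁆∪⁅y⁆∣≡2 (x≢y ∘ cong suc)

  length-subsetsThrough : ∀ {N} {x y : Fin N} {B} k → x ≢ y → x ∈ₛ B → y ∈ₛ B → 2 ≤ k →
                          length (subsetsBetween (⁅ x ⁆ ∪ ⁅ y ⁆) B k) ≡ choose (∣ B ∣ ∸ 2) (k ∸ 2)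
  length-subsetsThrough {x = x} {y} {B} k x≢y x∈B y∈B 2≤k = begin
    length (subsetsBetween (⁅ x ⁆ ∪ ⁅ y ⁆) B k)
      ≡⟨ length-subsetsBetween _ B k (⁅x⁆∪⁅y⁆⊆ x∈B y∈B) (subst (_≤ k) (sym (∣⁅x⁆∪⁅y⁆∣≡2 x≢y)) 2≤k) ⟩
    choose (∣ B ∣ ∸ ∣ ⁅ x ⁆ ∪ ⁅ y ⁆ ∣) (k ∸ ∣ ⁅ x ⁆ ∪ ⁅ y ⁆ ∣)
      ≡⟨ cong (λ a → choose (∣ B ∣ ∸ a) (k ∸ a)) (∣⁅x⁆∪⁅y⁆∣≡2 x≢y) ⟩
    choose (∣ B ∣ ∸ 2) (k ∸ 2) ∎

  length-subsetsBetween-⊈ : ∀ {N} (A B C : Subset N) k → C ⊆ B →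
    length (filter (λ e → ¬? (e ⊆? C)) (subsetsBetween A B k)) ≡ length (subsetsBetween A B k) ∸ length (subsetsBetween A C k)
  length-subsetsBetween-⊈ A B C k C⊆B = begin
    length (filter (¬? ∘ (_⊆? C)) (subsetsBetween A B k))
      ≡⟨ ℕ.m+n∸m≡n (length (filter (_⊆? C) (subsetsBetween A B k))) _ ⟨
    length (filter (_⊆? C) (subsetsBetween A B k)) + length (filter (¬? ∘ (_⊆? C)) (subsetsBetween A B k))
      ∸ length (filter (_⊆? C) (subsetsBetween A B k))
      ≡⟨ cong₂ _∸_ (sym (length-partition (_⊆? C) (subsetsBetween A B k)))
                   (unique∧set⇒length≡ (Unique.filter⁺ (_⊆? C) (subsetsBetween-unique A B k)) (subsetsBetween-unique A C k)
                                       (mk⇔ inC inB)) ⟩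
    length (subsetsBetween A B k) ∸ length (subsetsBetween A C k) ∎
    where
    inC : ∀ {e} → e ∈ filter (_⊆? C) (subsetsBetween A B k) → e ∈ subsetsBetween A C k
    inC e∈ with ∈-filter⁻ (_⊆? C) e∈
    ... | e∈B , e⊆C with ∈-subsetsBetween⁻ A B k e∈B
    ...   | A⊆e , _ , size = ∈-subsetsBetween⁺ A C k A⊆e e⊆C size
    inB : ∀ {e} → e ∈ subsetsBetween A C k → e ∈ filter (_⊆? C) (subsetsBetween A B k)
    inB e∈ with ∈-subsetsBetween⁻ A C k e∈
    ... | A⊆e , e⊆C , size = ∈-filter⁺ (_⊆? C) (∈-subsetsBetween⁺ A B k A⊆e (⊆-trans e⊆C C⊆B) size) e⊆C

  length-subsetsThrough-⊈ : ∀ {N} {x y : Fin N} {B C} k → x ≢ y → x ∈ₛ C → y ∈ₛ C → C ⊆ B → 2 ≤ k →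
    length (filter (λ e → ¬? (e ⊆? C)) (subsetsBetween (⁅ x ⁆ ∪ ⁅ y ⁆) B k))
      ≡ choose (∣ B ∣ ∸ 2) (k ∸ 2) ∸ choose (∣ C ∣ ∸ 2) (k ∸ 2)
  length-subsetsThrough-⊈ {x = x} {y} {B} {C} k x≢y x∈C y∈C C⊆B 2≤k =
    trans (length-subsetsBetween-⊈ (⁅ x ⁆ ∪ ⁅ y ⁆) B C k C⊆B)
          (cong₂ _∸_ (length-subsetsThrough k x≢y (C⊆B x∈C) (C⊆B y∈C) 2≤k) (length-subsetsThrough k x≢y x∈C y∈C 2≤k))

module HypergraphBasics where

  open import Data.Bool.Base using (true; false)
  import Algebra.Properties.Semiring.Sum
  open import Function.Base using (_∘_)
  open import Data.Nat.Base using (ℕ; suc; _+_; _*_; _∸_)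
  import Data.Nat.Properties as ℕ
  open import Data.Fin as Fin using (Fin)
  open import Data.Fin.Properties using (punchInᵢ≢i)
  open import Data.Fin.Subset using (Subset; ∣_∣; inside; outside) renaming (_∈_ to _∈ₛ_)
  open import Data.Fin.Subset.Properties using (_∈?_)
  open import Data.List.Base using (List; []; _∷_; length; filter)
  open import Data.List.Relation.Unary.All using ([]; _∷_)
  open import Data.Vec.Base using ([]; _∷_)
  open import Data.Product using (_×_)
  open import Relation.Binary.PropositionalEquality using (_≡_; _≢_; refl; cong; cong₂; sym; trans; module ≡-Reasoning)
  open import Relation.Nullary using (Dec; yes; no; does; contradiction)
  open import Relation.Nullary.Decidable using (_×-dec_)
  open Indicator
  open ListCounting using (length-filter-∷)
  module ℕ* = Algebra.Properties.Semiring.Sum ℕ.+-*-semiring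

  contains? : ∀ {N} (x y : Fin N) e → Dec (x ∈ₛ e × y ∈ₛ e)
  contains? x y e = (x ∈? e) ×-dec (y ∈? e)

  edgesThrough : ∀ {N} → Hypergraph N → Fin N → Fin N → List (Subset N)
  edgesThrough H x y = filter (contains? x y) H

  module _ {N} (H : Hypergraph N) where

    adjℕ-≢ : ∀ {x y} → x ≢ y → adjℕ H x y ≡ length (edgesThrough H x y)
    adjℕ-≢ {x} {y} x≢y with x Fin.≟ y
    ... | yes x≡y = contradiction x≡y x≢y
    ... | no  _   = refl

    adjℕ-diag : ∀ x → adjℕ H x x ≡ 0
    adjℕ-diag x with x Fin.≟ x
    ... | yes _   = refl
    ... | no  x≢x = contradiction refl x≢x

  -- the number of hyperedges through x and y, without the convention adjℕ H x x = 0
  pairDegree : ∀ {N} → Hypergraph N → Fin N → Fin N → ℕ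
  pairDegree H x y = length (edgesThrough H x y)

  indicator-×-dec : ∀ {P Q : Set} (P? : Dec P) (Q? : Dec Q) → indicator (P? ×-dec Q?) ≡ indicator P? * indicator Q?
  indicator-×-dec P? Q? with does P? | does Q?
  ... | true  | true  = refl
  ... | true  | false = refl
  ... | false | _     = refl

  ∣p∣≡∑indicator : ∀ {N} (e : Subset N) → ∣ e ∣ ≡ ℕΣ.sum (λ w → indicator (w ∈? e))
  ∣p∣≡∑indicator []            = refl
  ∣p∣≡∑indicator (inside  ∷ e) = cong suc (∣p∣≡∑indicator e)
  ∣p∣≡∑indicator (outside ∷ e) = ∣p∣≡∑indicator e

  pairDegree-sym : ∀ {N} (H : Hypergraph N) x y → pairDegree H x y ≡ pairDegree H y x
  pairDegree-sym []      x y = refl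
  pairDegree-sym (e ∷ H) x y = begin
    length (edgesThrough (e ∷ H) x y)                           ≡⟨ length-filter-∷ _ e H ⟩
    indicator ((x ∈? e) ×-dec (y ∈? e)) + pairDegree H x y       ≡⟨ cong₂ _+_ (indicator-×-dec (x ∈? e) (y ∈? e)) (pairDegree-sym H x y) ⟩
    indicator (x ∈? e) * indicator (y ∈? e) + pairDegree H y x   ≡⟨ cong (_+ pairDegree H y x) (ℕ.*-comm (indicator (x ∈? e)) _) ⟩
    indicator (y ∈? e) * indicator (x ∈? e) + pairDegree H y x   ≡⟨ cong (_+ pairDegree H y x) (indicator-×-dec (y ∈? e) (x ∈? e)) ⟨
    indicator ((y ∈? e) ×-dec (x ∈? e)) + pairDegree H y x       ≡⟨ length-filter-∷ _ e H ⟨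
    length (edgesThrough (e ∷ H) y x)                           ∎
    where open ≡-Reasoning

  adjℕ-sym : ∀ {N} (H : Hypergraph N) x y → adjℕ H x y ≡ adjℕ H y x
  adjℕ-sym H x y with x Fin.≟ y
  ... | yes refl = sym (adjℕ-diag H x)
  ... | no  x≢y  = trans (pairDegree-sym H x y) (sym (adjℕ-≢ H (x≢y ∘ sym)))

  pairDegree-diag : ∀ {N} (H : Hypergraph N) v → pairDegree H v v ≡ degree H v
  pairDegree-diag []      v = refl
  pairDegree-diag (e ∷ H) v = begin
    length (edgesThrough (e ∷ H) v v)                 ≡⟨ length-filter-∷ _ e H ⟩
    indicator ((v ∈? e) ×-dec (v ∈? e)) + pairDegree H v v
                                                      ≡⟨ cong₂ _+_ (indicator-self (v ∈? e)) (pairDegree-diag H v) ⟩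
    indicator (v ∈? e) + degree H v                   ≡⟨ length-filter-∷ (v ∈?_) e H ⟨
    degree (e ∷ H) v                                  ∎
    where
    open ≡-Reasoning
    indicator-self : ∀ {P : Set} (P? : Dec P) → indicator (P? ×-dec P?) ≡ indicator P?
    indicator-self P? with does P?
    ... | true  = refl
    ... | false = refl

  pairDegree-rowSum : ∀ {N} k (H : Hypergraph N) → Uniform k H → ∀ v → ℕΣ.sum (pairDegree H v) ≡ degree H v * k
  pairDegree-rowSum {N} k []      []           v = ℕΣ.sum-zero {N} (λ _ → refl)
  pairDegree-rowSum     k (e ∷ H) (∣e∣≡k ∷ uH) v = begin
    ℕΣ.sum (λ w → pairDegree (e ∷ H) v w)
      ≡⟨ ℕΣ.sum-cong-≋ (λ w → trans (length-filter-∷ _ e H) (cong (_+ pairDegree H v w) (indicator-×-dec (v ∈? e) (w ∈? e)))) ⟩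
    ℕΣ.sum (λ w → indicator (v ∈? e) * indicator (w ∈? e) + pairDegree H v w)
      ≡⟨ ℕΣ.∑-distrib-+ (λ w → indicator (v ∈? e) * indicator (w ∈? e)) (pairDegree H v) ⟩
    ℕΣ.sum (λ w → indicator (v ∈? e) * indicator (w ∈? e)) + ℕΣ.sum (pairDegree H v)
      ≡⟨ cong₂ _+_ (sym (ℕ*.*-distribˡ-sum (indicator (v ∈? e)) (λ w → indicator (w ∈? e)))) (pairDegree-rowSum k H uH v) ⟩
    indicator (v ∈? e) * ℕΣ.sum (λ w → indicator (w ∈? e)) + degree H v * k
      ≡⟨ cong (λ s → indicator (v ∈? e) * s + degree H v * k) (trans (sym (∣p∣≡∑indicator e)) ∣e∣≡k) ⟩
    indicator (v ∈? e) * k + degree H v * k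
      ≡⟨ ℕ.*-distribʳ-+ k (indicator (v ∈? e)) (degree H v) ⟨
    (indicator (v ∈? e) + degree H v) * k
      ≡⟨ cong (_* k) (length-filter-∷ (v ∈?_) e H) ⟨
    degree (e ∷ H) v * k ∎
    where open ≡-Reasoning

  adjℕ-rowSum : ∀ {N} k (H : Hypergraph N) → Uniform k H → ∀ v → ℕΣ.sum (adjℕ H v) ≡ degree H v * (k ∸ 1)
  adjℕ-rowSum {suc N} k H uH v = begin
    ℕΣ.sum (adjℕ H v)                             ≡⟨ ℕ.m+n∸n≡m _ (degree H v) ⟨
    ℕΣ.sum (adjℕ H v) + degree H v ∸ degree H v   ≡⟨ cong (_∸ degree H v) withDiagonal ⟩
    degree H v * k ∸ degree H v                   ≡⟨ cong (degree H v * k ∸_) (ℕ.*-identityʳ (degree H v)) ⟨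
    degree H v * k ∸ degree H v * 1               ≡⟨ ℕ.*-distribˡ-∸ (degree H v) k 1 ⟨
    degree H v * (k ∸ 1)                          ∎
    where
    open ≡-Reasoning
    offDiagonal : ℕΣ.sum (λ b → adjℕ H v (Fin.punchIn v b)) ≡ ℕΣ.sum (λ b → pairDegree H v (Fin.punchIn v b))
    offDiagonal = ℕΣ.sum-cong-≋ (λ b → adjℕ-≢ H (punchInᵢ≢i v b ∘ sym))
    withDiagonal : ℕΣ.sum (adjℕ H v) + degree H v ≡ degree H v * k
    withDiagonal = begin
      ℕΣ.sum (adjℕ H v) + degree H v
        ≡⟨ cong (_+ degree H v) (trans (ℕΣ.sum-remove {i = v} (adjℕ H v)) (cong₂ _+_ (adjℕ-diag H v) offDiagonal)) ⟩
      ℕΣ.sum (λ b → pairDegree H v (Fin.punchIn v b)) + degree H v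
        ≡⟨ ℕ.+-comm (ℕΣ.sum (λ b → pairDegree H v (Fin.punchIn v b))) (degree H v) ⟩
      degree H v + ℕΣ.sum (λ b → pairDegree H v (Fin.punchIn v b))
        ≡⟨ cong (_+ ℕΣ.sum (λ b → pairDegree H v (Fin.punchIn v b))) (pairDegree-diag H v) ⟨
      pairDegree H v v + ℕΣ.sum (λ b → pairDegree H v (Fin.punchIn v b))
        ≡⟨ ℕΣ.sum-remove {i = v} (pairDegree H v) ⟨
      ℕΣ.sum (pairDegree H v)
        ≡⟨ pairDegree-rowSum k H uH v ⟩
      degree H v * k ∎

module SubsetOf where

  open import Data.Bool.Base using (true; false)
  open import Data.Nat.Base using (zero; suc)
  open import Data.Fin.Base using (Fin; zero; suc)
  open import Data.Fin.Properties using (any?)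
  open import Data.Fin.Subset using (Subset; ∣_∣; _⊆_) renaming (_∈_ to _∈ₛ_)
  open import Data.Fin.Subset.Properties using (_∈?_)
  open import Data.Product using (∃; _×_; _,_)
  open import Data.Vec.Base using (tabulate)
  open import Data.Vec.Properties using (lookup∘tabulate; []=⇒lookup; lookup⇒[]=)
  open import Level using (0ℓ)
  open import Relation.Binary.PropositionalEquality using (_≡_; refl; cong; trans; sym)
  open import Relation.Nullary using (¬_; does; yes; no; contradiction)
  open import Relation.Nullary.Decidable using (dec-true; decidable-stable; ¬?; _×-dec_)
  open import Relation.Unary using (Pred; Decidable)
  open Indicator

  subsetOf : ∀ {N} {P : Pred (Fin N) 0ℓ} → Decidable P → Subset N
  subsetOf P? = tabulate (λ x → does (P? x))

  module _ {N} {P : Pred (Fin N) 0ℓ} (P? : Decidable P) where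

    ∈-subsetOf⁺ : ∀ {x} → P x → x ∈ₛ subsetOf P?
    ∈-subsetOf⁺ {x} px = lookup⇒[]= x _ (trans (lookup∘tabulate _ x) (dec-true (P? x) px))

    ∈-subsetOf⁻ : ∀ {x} → x ∈ₛ subsetOf P? → P x
    ∈-subsetOf⁻ {x} x∈ with P? x | trans (sym (lookup∘tabulate (λ x → does (P? x)) x)) ([]=⇒lookup x∈)
    ... | yes px | _ = px

  ⊈⇒∃∉ : ∀ {N} {p q : Subset N} → ¬ p ⊆ q → ∃ λ x → x ∈ₛ p × ¬ x ∈ₛ q
  ⊈⇒∃∉ {p = p} {q} p⊈q with any? (λ x → (x ∈? p) ×-dec ¬? (x ∈? q))
  ... | yes witness = witness
  ... | no  none    = contradiction (λ {x} x∈p → decidable-stable (x ∈? q) (λ x∉q → none (x , x∈p , x∉q))) p⊈q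

  ∣subsetOf∣ : ∀ {N} {P : Pred (Fin N) 0ℓ} (P? : Decidable P) → ∣ subsetOf P? ∣ ≡ ℕΣ.sum (λ x → indicator (P? x))
  ∣subsetOf∣ {zero}  P? = refl
  ∣subsetOf∣ {suc N} P? with does (P? zero)
  ... | true  = cong suc (∣subsetOf∣ (λ x → P? (suc x)))
  ... | false = ∣subsetOf∣ (λ x → P? (suc x))

module CoronaVertices (t p m : ℕ) where

  open import Data.Nat.Base as ℕ using (zero; suc; _+_; _*_)
  import Data.Nat.Properties as ℕ
  open import Data.Fin as Fin using (Fin; zero; suc; combine; _↑ʳ_)
  import Data.Fin.Properties as Fin
  open import Data.Product using (_×_; _,_; proj₁; proj₂; ∃)
  open import Data.Sum using (_⊎_; inj₁; inj₂; [_,_])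
  open import Data.Empty using (⊥-elim)
  open import Data.Fin.Subset using (Subset; ∣_∣; _⊆_) renaming (_∈_ to _∈ₛ_)
  open import Data.Fin.Subset.Properties using (_∈?_; ⊆-antisym)
  open SubsetOf
  open import Function.Base using (_∘_)
  open import Relation.Binary.PropositionalEquality using (_≡_; _≢_; refl; cong₂; subst; sym; trans)
  open import Relation.Nullary using (Dec; ¬_)
  open import Relation.Nullary.Decidable using (_⊎-dec_; _×-dec_)
  open import Data.List.Base using (List; length; map)
  open import Data.List.Properties using (length-map)
  open import Data.List.Membership.Propositional using (_∈_)
  open import Data.List.Membership.Propositional.Properties using (∈-map⁺; ∈-map⁻)
  open import Data.List.Relation.Unary.Unique.Propositional using (Unique)
  import Data.List.Relation.Unary.Unique.Propositional.Properties as Unique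
  open import Function.Bundles using (_⇔_; mk⇔; Equivalence)
  open FinSplit
  open Indicator
  open ListCounting using (unique∧set⇒length≡)
  open HypergraphBasics using (edgesThrough; pairDegree)

  N : ℕ
  N = coronaOrder t p m

  base : Fin t → Fin p → Fin N
  base i q = baseV t p m (combine i q)

  copy : Fin t → Fin p → Fin m → Fin N
  copy = copyV t p m

  base-injective : ∀ {i q i′ q′} → base i q ≡ base i′ q′ → i ≡ i′ × q ≡ q′
  base-injective eq = Fin.combine-injective _ _ _ _ (Fin.↑ˡ-injective _ _ _ eq)

  copy-injective : ∀ {i j w i′ j′ w′} → copy i j w ≡ copy i′ j′ w′ → i ≡ i′ × j ≡ j′ × w ≡ w′
  copy-injective eq with Fin.combine-injective _ _ _ _ (Fin.↑ʳ-injective (t * p) _ _ eq)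
  ... | ij≡i′j′ , w≡w′ with Fin.combine-injective _ _ _ _ ij≡i′j′
  ...   | i≡i′ , j≡j′ = i≡i′ , j≡j′ , w≡w′

  base≢copy : ∀ {i q i′ j w} → base i q ≢ copy i′ j w
  base≢copy = ↑ˡ≢↑ʳ _ _

  InPart′ : Fin t → Fin N → Set
  InPart′ = InPart t p m
  InCopy′ : Fin t → Fin p → Fin N → Set
  InCopy′ = InCopy t p m

  inPart? : ∀ i x → Dec (InPart′ i x)
  inPart? i x = Fin.any? (λ q → x Fin.≟ base i q)

  inCopy? : ∀ i j x → Dec (InCopy′ i j x)
  inCopy? i j x = Fin.any? (λ w → x Fin.≟ copy i j w)

  inPart-base : ∀ {i i′ q} → InPart′ i (base i′ q) → i′ ≡ i
  inPart-base (_ , eq) = proj₁ (base-injective eq)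

  inPart-copy : ∀ {i i′ j w} → ¬ InPart′ i (copy i′ j w)
  inPart-copy (_ , eq) = base≢copy (sym eq)

  inCopy-copy : ∀ {i j i′ j′ w} → InCopy′ i j (copy i′ j′ w) → i′ ≡ i × j′ ≡ j
  inCopy-copy (_ , eq) with copy-injective eq
  ... | i′≡i , j′≡j , _ = i′≡i , j′≡j

  inCopy-base : ∀ {i j i′ q} → ¬ InCopy′ i j (base i′ q)
  inCopy-base (_ , eq) = base≢copy eq

  inPart×inCopy : ∀ {i i′ j z} → InPart′ i z → ¬ InCopy′ i′ j z
  inPart×inCopy (_ , refl) = inCopy-base

  IsBase : Fin N → Set
  IsBase z = ∃ λ u → z ≡ baseV t p m u

  isBase? : ∀ z → Dec (IsBase z)
  isBase? z = Fin.any? (λ u → z Fin.≟ baseV t p m u)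

  inCopy⇒¬isBase : ∀ {i j z} → InCopy′ i j z → ¬ IsBase z
  inCopy⇒¬isBase (_ , refl) (_ , eq) = ↑ˡ≢↑ʳ _ _ (sym eq)

  partRegion : Fin t → Subset N
  partRegion i = subsetOf (inPart? i)

  copyRegion : Fin t → Fin p → Subset N
  copyRegion i j = subsetOf (inCopy? i j)

  inCross? : ∀ i j x → Dec (InPart′ i x ⊎ InCopy′ i j x)
  inCross? i j x = inPart? i x ⊎-dec inCopy? i j x

  crossRegion : Fin t → Fin p → Subset N
  crossRegion i j = subsetOf (inCross? i j)

  baseRegion : Subset N
  baseRegion = subsetOf isBase?

  copyRegion⊆crossRegion : ∀ i j → copyRegion i j ⊆ crossRegion i j
  copyRegion⊆crossRegion i j z∈ = ∈-subsetOf⁺ (inCross? i j) (inj₂ (∈-subsetOf⁻ (inCopy? i j) z∈))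

  partRegion⊆crossRegion : ∀ i j → partRegion i ⊆ crossRegion i j
  partRegion⊆crossRegion i j z∈ = ∈-subsetOf⁺ (inCross? i j) (inj₁ (∈-subsetOf⁻ (inPart? i) z∈))

  sum-vertices : ∀ (F : Fin N → ℕ) →
    ℕΣ.sum F ≡ ℕΣ.sum (λ i → ℕΣ.sum (λ q → F (base i q))) + ℕΣ.sum (λ i → ℕΣ.sum (λ j → ℕΣ.sum (λ w → F (copy i j w))))
  sum-vertices F = trans (ℕΣ.sum-↑ (t * p) F)
    (cong₂ _+_ (ℕΣ.sum-combine t (λ u → F (baseV t p m u)))
               (trans (ℕΣ.sum-combine (t * p) (λ v → F ((t * p) ↑ʳ v)))
                      (ℕΣ.sum-combine t (λ g → ℕΣ.sum {m} (λ w → F ((t * p) ↑ʳ combine g w))))))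

  module _ {P : Fin N → Set} (P? : ∀ x → Dec (P x)) where

    count-base : ∀ i → (∀ {i′ q} → P (base i′ q) → i′ ≡ i) → (∀ q → P (base i q)) →
                 ℕΣ.sum (λ i′ → ℕΣ.sum (λ q → indicator (P? (base i′ q)))) ≡ p
    count-base i only all = trans
      (ℕΣ.sum-single i (λ i′ i′≢i → ℕΣ.sum-zero {p} (λ q → indicator-no (P? _) (i′≢i ∘ only))))
      (trans (ℕΣ.sum-cong-≋ (λ q → indicator-yes (P? _) (all q))) (trans (ℕΣ-const p 1) (ℕ.*-identityʳ p)))

    count-copy : ∀ i j → (∀ {i′ j′ w} → P (copy i′ j′ w) → i′ ≡ i × j′ ≡ j) → (∀ w → P (copy i j w)) →
                 ℕΣ.sum (λ i′ → ℕΣ.sum (λ j′ → ℕΣ.sum (λ w → indicator (P? (copy i′ j′ w))))) ≡ m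
    count-copy i j only all = trans
      (ℕΣ.sum-single i (λ i′ i′≢i → ℕΣ.sum-zero {p} (λ j′ → ℕΣ.sum-zero {m} (λ w → indicator-no (P? _) (i′≢i ∘ proj₁ ∘ only)))))
      (trans (ℕΣ.sum-single j (λ j′ j′≢j → ℕΣ.sum-zero {m} (λ w → indicator-no (P? _) (j′≢j ∘ proj₂ ∘ only))))
             (trans (ℕΣ.sum-cong-≋ (λ w → indicator-yes (P? _) (all w))) (trans (ℕΣ-const m 1) (ℕ.*-identityʳ m))))

    count-noBase : (∀ {i q} → ¬ P (base i q)) → ℕΣ.sum (λ i → ℕΣ.sum (λ q → indicator (P? (base i q)))) ≡ 0
    count-noBase none = ℕΣ.sum-zero {t} (λ i → ℕΣ.sum-zero {p} (λ q → indicator-no (P? _) none))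

    count-noCopy : (∀ {i j w} → ¬ P (copy i j w)) →
                   ℕΣ.sum (λ i → ℕΣ.sum (λ j → ℕΣ.sum (λ w → indicator (P? (copy i j w))))) ≡ 0
    count-noCopy none = ℕΣ.sum-zero {t} (λ i → ℕΣ.sum-zero {p} (λ j → ℕΣ.sum-zero {m} (λ w → indicator-no (P? _) none)))

  ∣partRegion∣ : ∀ i → ∣ partRegion i ∣ ≡ p
  ∣partRegion∣ i = trans (∣subsetOf∣ (inPart? i)) (trans (sum-vertices _)
    (trans (cong₂ _+_ (count-base (inPart? i) i inPart-base (λ q → q , refl)) (count-noCopy (inPart? i) inPart-copy))
           (ℕ.+-identityʳ p)))

  ∣copyRegion∣ : ∀ i j → ∣ copyRegion i j ∣ ≡ m
  ∣copyRegion∣ i j = trans (∣subsetOf∣ (inCopy? i j)) (trans (sum-vertices _)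
    (cong₂ _+_ (count-noBase (inCopy? i j) inCopy-base) (count-copy (inCopy? i j) i j inCopy-copy (λ w → w , refl))))

  ∣crossRegion∣ : ∀ i j → ∣ crossRegion i j ∣ ≡ p + m
  ∣crossRegion∣ i j = trans (∣subsetOf∣ (inCross? i j)) (trans (sum-vertices _)
    (cong₂ _+_ (count-base (inCross? i j) i [ inPart-base , ⊥-elim ∘ inCopy-base ] (λ q → inj₁ (q , refl)))
               (count-copy (inCross? i j) i j [ ⊥-elim ∘ inPart-copy , inCopy-copy ] (λ w → inj₂ (w , refl)))))

  inImage? : ∀ {M} (g : Fin M → Fin N) f z → Dec (∃ λ y → y ∈ₛ f × g y ≡ z)
  inImage? g f z = Fin.any? (λ y → (y ∈? f) ×-dec (g y Fin.≟ z))

  image : ∀ {M} → (Fin M → Fin N) → Subset M → Subset N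
  image g f = subsetOf (inImage? g f)

  module _ {M} {g : Fin M → Fin N} where

    image-isImage : ∀ f → IsImage t p m g f (image g f)
    image-isImage f z = ∈-subsetOf⁻ (inImage? g f) , (λ y y∈f → ∈-subsetOf⁺ (inImage? g f) (y , y∈f , refl))

    isImage-∈ : ∀ {f e} → IsImage t p m g f e → ∀ {y} → y ∈ₛ f → g y ∈ₛ e
    isImage-∈ img {y} y∈f = proj₂ (img (g y)) y y∈f

    isImage-functional : ∀ {f e e′} → IsImage t p m g f e → IsImage t p m g f e′ → e ≡ e′
    isImage-functional img img′ = ⊆-antisym (⊆ img img′) (⊆ img′ img)
      where
      ⊆ : ∀ {e e′ f} → IsImage t p m g f e → IsImage t p m g f e′ → e ⊆ e′
      ⊆ img img′ {z} z∈e with proj₁ (img z) z∈e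
      ... | y , y∈f , refl = isImage-∈ img′ y∈f

    isImage-injective : (∀ {a b} → g a ≡ g b → a ≡ b) → ∀ {f f′ e} → IsImage t p m g f e → IsImage t p m g f′ e → f ≡ f′
    isImage-injective g-inj img img′ = ⊆-antisym (⊆ img img′) (⊆ img′ img)
      where
      ⊆ : ∀ {f f′ e} → IsImage t p m g f e → IsImage t p m g f′ e → f ⊆ f′
      ⊆ {f′ = f′} img img′ {y} y∈f with proj₁ (img′ (g y)) (isImage-∈ img y∈f)
      ... | y′ , y′∈f′ , gy′≡gy = subst (_∈ₛ f′) (g-inj gy′≡gy) y′∈f′

  length-images : ∀ {M} (g : Fin M → Fin N) → (∀ {a b} → g a ≡ g b → a ≡ b) →
    ∀ (H : Hypergraph M) → Unique H → ∀ a b {L : List (Subset N)} → Unique L →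
    (∀ {e} → e ∈ L ⇔ (∃ λ f → f ∈ edgesThrough H a b × IsImage t p m g f e)) → length L ≡ pairDegree H a b
  length-images g g-inj H H-unique a b {L} L-unique L⇔ =
    trans (unique∧set⇒length≡ L-unique images-unique (mk⇔ toImages fromImages)) (length-map (image g) (edgesThrough H a b))
    where
    images-unique : Unique (map (image g) (edgesThrough H a b))
    images-unique = Unique.map⁺ (λ {f} {f′} eq → isImage-injective g-inj (image-isImage f)
                                                   (subst (IsImage t p m g f′) (sym eq) (image-isImage f′)))
                                (Unique.filter⁺ _ H-unique)
    toImages : ∀ {e} → e ∈ L → e ∈ map (image g) (edgesThrough H a b)
    toImages e∈ with Equivalence.to L⇔ e∈
    ... | f , f∈ , img = subst (_∈ map (image g) (edgesThrough H a b)) (isImage-functional (image-isImage f) img) (∈-map⁺ (image g) f∈)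
    fromImages : ∀ {e} → e ∈ map (image g) (edgesThrough H a b) → e ∈ L
    fromImages e∈ with ∈-map⁻ (image g) e∈
    ... | f , f∈ , refl = Equivalence.from L⇔ (f , f∈ , image-isImage f)

module CoronaEdges (t p m k : ℕ) (2≤k : 2 ≤ k)
  (G₀ : Hypergraph (t ℕ.* p)) (G₀-unique : Unique G₀)
  (Gs : Fin t → Hypergraph m) (Gs-unique : ∀ i → Unique (Gs i))
  (G : Hypergraph (coronaOrder t p m)) (G-unique : Unique G)
  (G-edges : ∀ e → (e ∈ G → CoronaEdge t p m k G₀ Gs e) × (CoronaEdge t p m k G₀ Gs e → e ∈ G))
  where

  open import Data.Nat.Base using (zero; suc; _+_; _*_; _∸_)
  import Data.Nat.Properties as ℕ
  open import Data.Fin as Fin using (zero; suc; combine)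
  import Data.Fin.Properties as Fin
  open import Data.Fin.Subset using (Subset; ∣_∣; _⊆_; ⁅_⁆; _∪_) renaming (_∈_ to _∈ₛ_)
  open import Data.Fin.Subset.Properties using (_⊆?_)
  open import Data.List.Base using (List; length; filter)
  open import Data.List.Membership.Propositional.Properties using (∈-filter⁺; ∈-filter⁻)
  import Data.List.Relation.Unary.Unique.Propositional.Properties as Unique
  import Data.List.Relation.Unary.AllPairs as AllPairs
  open import Data.Product using (_,_; proj₁; proj₂; ∃; ∃₂)
  open import Data.Sum using (_⊎_; inj₁; inj₂)
  open import Data.Empty using (⊥; ⊥-elim)
  open import Function.Base using (_∘_)
  open import Function.Bundles using (mk⇔)
  open import Relation.Binary.PropositionalEquality using (_≡_; _≢_; refl; cong; cong₂; subst; sym; trans; module ≡-Reasoning)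
  open import Relation.Nullary using (¬_; contradiction)
  open import Relation.Nullary.Decidable using (¬?)
  open CoronaVertices t p m
  open SubsetOf
  open SubsetsBetween
  open ListCounting
  open HypergraphBasics

  Edge : Subset N → Set
  Edge = CoronaEdge t p m k G₀ Gs

  CrossEdge : Fin t → Fin p → Subset N → Set
  CrossEdge i j e = ∣ e ∣ ≡ k × (∀ x → x ∈ₛ e → InPart′ i x ⊎ InCopy′ i j x)
                  × (∃ λ x → x ∈ₛ e × InPart′ i x) × (∃ λ x → x ∈ₛ e × InCopy′ i j x)

  ∈-edgesThrough⁻ : ∀ {x y e} → e ∈ edgesThrough G x y → Edge e × x ∈ₛ e × y ∈ₛ e
  ∈-edgesThrough⁻ {x} {y} e∈ with ∈-filter⁻ (contains? x y) e∈
  ... | e∈G , x∈e , y∈e = proj₁ (G-edges _) e∈G , x∈e , y∈e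

  ∈-edgesThrough⁺ : ∀ {x y e} → Edge e → x ∈ₛ e → y ∈ₛ e → e ∈ edgesThrough G x y
  ∈-edgesThrough⁺ {x} {y} edge x∈e y∈e = ∈-filter⁺ (contains? x y) (proj₂ (G-edges _) edge) (x∈e , y∈e)

  baseEdge-noCopy : ∀ {f e i j w} → IsImage t p m (baseV t p m) f e → copy i j w ∈ₛ e → ⊥
  baseEdge-noCopy img z∈e with proj₁ (img _) z∈e
  ... | u , _ , eq = FinSplit.↑ˡ≢↑ʳ _ _ eq

  copyEdge-inCopy : ∀ {i j f e z} → IsImage t p m (copy i j) f e → z ∈ₛ e → InCopy′ i j z
  copyEdge-inCopy img z∈e with proj₁ (img _) z∈e
  ... | w , _ , eq = w , sym eq

  ⊆crossRegion : ∀ {i j e} → (∀ x → x ∈ₛ e → InPart′ i x ⊎ InCopy′ i j x) → e ⊆ crossRegion i j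
  ⊆crossRegion {i} {j} inside z∈e = ∈-subsetOf⁺ (inCross? i j) (inside _ z∈e)

  crossRegion⊆ : ∀ {i j e} → e ⊆ crossRegion i j → ∀ x → x ∈ₛ e → InPart′ i x ⊎ InCopy′ i j x
  crossRegion⊆ {i} {j} e⊆ x x∈e = ∈-subsetOf⁻ (inCross? i j) (e⊆ x∈e)

  crossSubsets : Fin t → Fin p → Fin N → Fin N → List (Subset N)
  crossSubsets i j x y = subsetsBetween (⁅ x ⁆ ∪ ⁅ y ⁆) (crossRegion i j) k

  crossSubsets-unique : ∀ i j x y → Unique (crossSubsets i j x y)
  crossSubsets-unique i j x y = subsetsBetween-unique (⁅ x ⁆ ∪ ⁅ y ⁆) (crossRegion i j) k

  edgesThrough-unique : ∀ x y → Unique (edgesThrough G x y)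
  edgesThrough-unique x y = Unique.filter⁺ (contains? x y) G-unique

  ∈-crossSubsets⁻ : ∀ {i j x y e} → e ∈ crossSubsets i j x y →
                    x ∈ₛ e × y ∈ₛ e × (∀ z → z ∈ₛ e → InPart′ i z ⊎ InCopy′ i j z) × ∣ e ∣ ≡ k
  ∈-crossSubsets⁻ {i} {j} {x} {y} e∈ with ∈-subsetsBetween⁻ (⁅ x ⁆ ∪ ⁅ y ⁆) (crossRegion i j) k e∈
  ... | xy⊆e , e⊆ , size = proj₁ (⁅x⁆∪⁅y⁆⊆⁻ xy⊆e) , proj₂ (⁅x⁆∪⁅y⁆⊆⁻ xy⊆e) , crossRegion⊆ e⊆ , size

  ∈-crossSubsets⁺ : ∀ {i j x y e} → x ∈ₛ e → y ∈ₛ e → (∀ z → z ∈ₛ e → InPart′ i z ⊎ InCopy′ i j z) → ∣ e ∣ ≡ k →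
                    e ∈ crossSubsets i j x y
  ∈-crossSubsets⁺ {i} {j} {x} {y} x∈e y∈e inside size =
    ∈-subsetsBetween⁺ (⁅ x ⁆ ∪ ⁅ y ⁆) (crossRegion i j) k (⁅x⁆∪⁅y⁆⊆ x∈e y∈e) (⊆crossRegion inside) size

  adj-base-copy : ∀ i q j w → adjℕ G (base i q) (copy i j w) ≡ coefB k p m
  adj-base-copy i q j w = begin
    adjℕ G x y
      ≡⟨ adjℕ-≢ G base≢copy ⟩
    length (edgesThrough G x y)
      ≡⟨ unique∧set⇒length≡ (edgesThrough-unique x y) (crossSubsets-unique i j x y) (mk⇔ toCross fromCross) ⟩
    length (crossSubsets i j x y)
      ≡⟨ length-subsetsThrough k base≢copy (⊆crossRegion′ (inj₁ (q , refl))) (⊆crossRegion′ (inj₂ (w , refl))) 2≤k ⟩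
    choose (∣ crossRegion i j ∣ ∸ 2) (k ∸ 2)
      ≡⟨ cong (λ s → choose (s ∸ 2) (k ∸ 2)) (∣crossRegion∣ i j) ⟩
    coefB k p m ∎
    where
    open ≡-Reasoning
    x y : Fin N
    x = base i q
    y = copy i j w
    ⊆crossRegion′ : ∀ {z} → InPart′ i z ⊎ InCopy′ i j z → z ∈ₛ crossRegion i j
    ⊆crossRegion′ = ∈-subsetOf⁺ (inCross? i j)
    toCross : ∀ {e} → e ∈ edgesThrough G x y → e ∈ crossSubsets i j x y
    toCross e∈ with ∈-edgesThrough⁻ e∈
    ... | inj₁ (_ , _ , img) , _ , y∈e = ⊥-elim (baseEdge-noCopy img y∈e)
    ... | inj₂ (inj₁ (_ , _ , _ , _ , img)) , x∈e , _ = ⊥-elim (inCopy-base (copyEdge-inCopy img x∈e))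
    ... | inj₂ (inj₂ (_ , _ , size , inside , _)) , x∈e , y∈e with inside y y∈e
    ...   | inj₁ y∈U = ⊥-elim (inPart-copy y∈U)
    ...   | inj₂ y∈W with inCopy-copy y∈W
    ...     | refl , refl = ∈-crossSubsets⁺ x∈e y∈e inside size
    fromCross : ∀ {e} → e ∈ crossSubsets i j x y → e ∈ edgesThrough G x y
    fromCross e∈ with ∈-crossSubsets⁻ e∈
    ... | x∈e , y∈e , inside , size =
      ∈-edgesThrough⁺ (inj₂ (inj₂ (i , j , size , inside , (x , x∈e , q , refl) , (y , y∈e , w , refl)))) x∈e y∈e

  adj-base-copy-otherPart : ∀ {i i′} q j w → i ≢ i′ → adjℕ G (base i q) (copy i′ j w) ≡ 0
  adj-base-copy-otherPart {i} {i′} q j w i≢i′ = trans (adjℕ-≢ G base≢copy) (length-noMembers noEdge)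
    where
    noEdge : ∀ {e} → e ∈ edgesThrough G (base i q) (copy i′ j w) → ⊥
    noEdge e∈ with ∈-edgesThrough⁻ e∈
    ... | inj₁ (_ , _ , img) , _ , y∈e = baseEdge-noCopy img y∈e
    ... | inj₂ (inj₁ (_ , _ , _ , _ , img)) , x∈e , _ = inCopy-base (copyEdge-inCopy img x∈e)
    ... | inj₂ (inj₂ (_ , _ , _ , inside , _)) , x∈e , y∈e with inside _ x∈e | inside _ y∈e
    ...   | inj₂ x∈W | _        = inCopy-base x∈W
    ...   | _        | inj₁ y∈U = inPart-copy y∈U
    ...   | inj₁ x∈U | inj₂ y∈W = i≢i′ (trans (inPart-base x∈U) (sym (proj₁ (inCopy-copy y∈W))))

  adj-copy-copy-otherCopy : ∀ {i j i′ j′} w w′ → ¬ (i ≡ i′ × j ≡ j′) → adjℕ G (copy i j w) (copy i′ j′ w′) ≡ 0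
  adj-copy-copy-otherCopy {i} {j} {i′} {j′} w w′ ij≢i′j′ =
    trans (adjℕ-≢ G (ij≢i′j′ ∘ sameCopy ∘ copy-injective)) (length-noMembers noEdge)
    where
    sameCopy : ∀ {a b c} → a × b × c → a × b
    sameCopy (a , b , _) = a , b
    noEdge : ∀ {e} → e ∈ edgesThrough G (copy i j w) (copy i′ j′ w′) → ⊥
    noEdge e∈ with ∈-edgesThrough⁻ e∈
    ... | inj₁ (_ , _ , img) , x∈e , _ = baseEdge-noCopy img x∈e
    ... | inj₂ (inj₁ (_ , _ , _ , _ , img)) , x∈e , y∈e with inCopy-copy (copyEdge-inCopy img x∈e) | inCopy-copy (copyEdge-inCopy img y∈e)
    ...   | refl , refl | refl , refl = ij≢i′j′ (refl , refl)
    noEdge e∈ | inj₂ (inj₂ (_ , _ , _ , inside , _)) , x∈e , y∈e with inside _ x∈e | inside _ y∈e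
    ...   | inj₁ x∈U | _        = inPart-copy x∈U
    ...   | _        | inj₁ y∈U = inPart-copy y∈U
    ...   | inj₂ x∈W | inj₂ y∈W with inCopy-copy x∈W | inCopy-copy y∈W
    ...     | refl , refl | refl , refl = ij≢i′j′ (refl , refl)

  copyEdge-preimage : ∀ {i j f e a} → IsImage t p m (copy i j) f e → copy i j a ∈ₛ e → a ∈ₛ f
  copyEdge-preimage {f = f} img a∈e with proj₁ (img _) a∈e
  ... | a′ , a′∈f , eq = subst (_∈ₛ f) (proj₂ (proj₂ (copy-injective eq))) a′∈f

  module CopyCopy (i : Fin t) (j : Fin p) {w w′ : Fin m} (w≢w′ : w ≢ w′) where

    open ≡-Reasoning

    x y : Fin N
    x = copy i j w
    y = copy i j w′

    x≢y : x ≢ y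
    x≢y = w≢w′ ∘ proj₂ ∘ proj₂ ∘ copy-injective

    C : Subset N
    C = copyRegion i j

    L : List (Subset N)
    L = edgesThrough G x y

    toImage : ∀ {e} → e ∈ filter (_⊆? C) L → ∃ λ f → f ∈ edgesThrough (Gs i) w w′ × IsImage t p m (copy i j) f e
    toImage e∈ with ∈-filter⁻ (_⊆? C) e∈
    ... | e∈L , e⊆C with ∈-edgesThrough⁻ e∈L
    ...   | inj₁ (_ , _ , img) , x∈e , _ = ⊥-elim (baseEdge-noCopy img x∈e)
    ...   | inj₂ (inj₂ (_ , _ , _ , _ , (z , z∈e , z∈U) , _)) , _ , _ =
      ⊥-elim (inPart×inCopy z∈U (∈-subsetOf⁻ (inCopy? i j) (e⊆C z∈e)))
    ...   | inj₂ (inj₁ (_ , _ , f , f∈Gs , img)) , x∈e , y∈e with inCopy-copy (copyEdge-inCopy img x∈e)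
    ...     | refl , refl = f , ∈-filter⁺ (contains? w w′) f∈Gs (copyEdge-preimage img x∈e , copyEdge-preimage img y∈e) , img

    fromImage : ∀ {e} → (∃ λ f → f ∈ edgesThrough (Gs i) w w′ × IsImage t p m (copy i j) f e) → e ∈ filter (_⊆? C) L
    fromImage (f , f∈ , img) with ∈-filter⁻ (contains? w w′) f∈
    ... | f∈Gs , w∈f , w′∈f = ∈-filter⁺ (_⊆? C)
      (∈-edgesThrough⁺ (inj₂ (inj₁ (i , j , f , f∈Gs , img))) (isImage-∈ img w∈f) (isImage-∈ img w′∈f))
      (λ z∈e → ∈-subsetOf⁺ (inCopy? i j) (copyEdge-inCopy img z∈e))

    insideCopy : length (filter (_⊆? C) L) ≡ adjℕ (Gs i) w w′
    insideCopy = trans (length-images (copy i j) (proj₂ ∘ proj₂ ∘ copy-injective) (Gs i) (Gs-unique i) w w′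
                                      (Unique.filter⁺ (_⊆? C) (edgesThrough-unique x y)) (mk⇔ toImage fromImage))
                       (sym (adjℕ-≢ (Gs i) w≢w′))

    toCross : ∀ {e} → e ∈ filter (¬? ∘ (_⊆? C)) L → e ∈ filter (¬? ∘ (_⊆? C)) (crossSubsets i j x y)
    toCross e∈ with ∈-filter⁻ (¬? ∘ (_⊆? C)) e∈
    ... | e∈L , e⊈C with ∈-edgesThrough⁻ e∈L
    ...   | inj₁ (_ , _ , img) , x∈e , _ = ⊥-elim (baseEdge-noCopy img x∈e)
    ...   | inj₂ (inj₁ (_ , _ , _ , _ , img)) , x∈e , _ with inCopy-copy (copyEdge-inCopy img x∈e)
    ...     | refl , refl = ⊥-elim (e⊈C (λ z∈e → ∈-subsetOf⁺ (inCopy? i j) (copyEdge-inCopy img z∈e)))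
    toCross e∈ | e∈L , e⊈C | inj₂ (inj₂ (_ , _ , size , inside , _)) , x∈e , y∈e with inside x x∈e
    ...     | inj₁ x∈U = ⊥-elim (inPart-copy x∈U)
    ...     | inj₂ x∈W with inCopy-copy x∈W
    ...       | refl , refl = ∈-filter⁺ (¬? ∘ (_⊆? C)) (∈-crossSubsets⁺ x∈e y∈e inside size) e⊈C

    fromCross : ∀ {e} → e ∈ filter (¬? ∘ (_⊆? C)) (crossSubsets i j x y) → e ∈ filter (¬? ∘ (_⊆? C)) L
    fromCross e∈ with ∈-filter⁻ (¬? ∘ (_⊆? C)) e∈
    ... | e∈cross , e⊈C with ∈-crossSubsets⁻ e∈cross | ⊈⇒∃∉ e⊈C
    ...   | x∈e , y∈e , inside , size | z , z∈e , z∉C with inside z z∈e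
    ...     | inj₂ z∈W = ⊥-elim (z∉C (∈-subsetOf⁺ (inCopy? i j) z∈W))
    ...     | inj₁ z∈U = ∈-filter⁺ (¬? ∘ (_⊆? C))
      (∈-edgesThrough⁺ (inj₂ (inj₂ (i , j , size , inside , (z , z∈e , z∈U) , (x , x∈e , w , refl)))) x∈e y∈e) e⊈C

    leavingCopy : length (filter (¬? ∘ (_⊆? C)) L) ≡ coefC k p m
    leavingCopy = begin
      length (filter (¬? ∘ (_⊆? C)) L)
        ≡⟨ unique∧set⇒length≡ (Unique.filter⁺ _ (edgesThrough-unique x y)) (Unique.filter⁺ _ (crossSubsets-unique i j x y))
                              (mk⇔ toCross fromCross) ⟩
      length (filter (¬? ∘ (_⊆? C)) (crossSubsets i j x y))
        ≡⟨ length-subsetsThrough-⊈ k x≢y (∈-subsetOf⁺ (inCopy? i j) (w , refl)) (∈-subsetOf⁺ (inCopy? i j) (w′ , refl))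
                                   (copyRegion⊆crossRegion i j) 2≤k ⟩
      choose (∣ crossRegion i j ∣ ∸ 2) (k ∸ 2) ∸ choose (∣ C ∣ ∸ 2) (k ∸ 2)
        ≡⟨ cong₂ (λ a b → choose (a ∸ 2) (k ∸ 2) ∸ choose (b ∸ 2) (k ∸ 2)) (∣crossRegion∣ i j) (∣copyRegion∣ i j) ⟩
      coefC k p m ∎

  adj-copy-copy : ∀ i j {w w′} → w ≢ w′ → adjℕ G (copy i j w) (copy i j w′) ≡ coefC k p m + adjℕ (Gs i) w w′
  adj-copy-copy i j {w} {w′} w≢w′ = begin
    adjℕ G x y                                                      ≡⟨ adjℕ-≢ G x≢y ⟩
    length L                                                        ≡⟨ length-partition (_⊆? C) L ⟩
    length (filter (_⊆? C) L) + length (filter (¬? ∘ (_⊆? C)) L)    ≡⟨ cong₂ _+_ insideCopy leavingCopy ⟩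
    adjℕ (Gs i) w w′ + coefC k p m                                  ≡⟨ ℕ.+-comm _ (coefC k p m) ⟩
    coefC k p m + adjℕ (Gs i) w w′                                  ∎
    where
    open ≡-Reasoning
    open CopyCopy i j w≢w′

  baseV-injective : ∀ {u u′} → baseV t p m u ≡ baseV t p m u′ → u ≡ u′
  baseV-injective = Fin.↑ˡ-injective _ _ _

  baseEdge-preimage : ∀ {f e u} → IsImage t p m (baseV t p m) f e → baseV t p m u ∈ₛ e → u ∈ₛ f
  baseEdge-preimage {f = f} img u∈e with proj₁ (img _) u∈e
  ... | u′ , u′∈f , eq = subst (_∈ₛ f) (baseV-injective eq) u′∈f

  baseEdge-⊆ : ∀ {f e} → IsImage t p m (baseV t p m) f e → e ⊆ baseRegion
  baseEdge-⊆ img z∈e with proj₁ (img _) z∈e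
  ... | u , _ , eq = ∈-subsetOf⁺ isBase? (u , sym eq)

  module BaseBase {u u′ : Fin (t * p)} (u≢u′ : u ≢ u′) where

    x y : Fin N
    x = baseV t p m u
    y = baseV t p m u′

    L : List (Subset N)
    L = edgesThrough G x y

    x≢y : x ≢ y
    x≢y = u≢u′ ∘ baseV-injective

    toImage : ∀ {e} → e ∈ filter (_⊆? baseRegion) L → ∃ λ f → f ∈ edgesThrough G₀ u u′ × IsImage t p m (baseV t p m) f e
    toImage e∈ with ∈-filter⁻ (_⊆? baseRegion) e∈
    ... | e∈L , e⊆B with ∈-edgesThrough⁻ e∈L
    ...   | inj₁ (f , f∈G₀ , img) , x∈e , y∈e =
      f , ∈-filter⁺ (contains? u u′) f∈G₀ (baseEdge-preimage img x∈e , baseEdge-preimage img y∈e) , img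
    ...   | inj₂ (inj₁ (_ , _ , _ , _ , img)) , x∈e , _ =
      ⊥-elim (inCopy⇒¬isBase (copyEdge-inCopy img x∈e) (u , refl))
    ...   | inj₂ (inj₂ (_ , _ , _ , _ , _ , (z , z∈e , z∈W))) , _ , _ =
      ⊥-elim (inCopy⇒¬isBase z∈W (∈-subsetOf⁻ isBase? (e⊆B z∈e)))

    fromImage : ∀ {e} → (∃ λ f → f ∈ edgesThrough G₀ u u′ × IsImage t p m (baseV t p m) f e) → e ∈ filter (_⊆? baseRegion) L
    fromImage (f , f∈ , img) with ∈-filter⁻ (contains? u u′) f∈
    ... | f∈G₀ , u∈f , u′∈f =
      ∈-filter⁺ (_⊆? baseRegion) (∈-edgesThrough⁺ (inj₁ (f , f∈G₀ , img)) (isImage-∈ img u∈f) (isImage-∈ img u′∈f)) (baseEdge-⊆ img)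

    insideBase : length (filter (_⊆? baseRegion) L) ≡ adjℕ G₀ u u′
    insideBase = trans (length-images (baseV t p m) baseV-injective G₀ G₀-unique u u′
                                      (Unique.filter⁺ (_⊆? baseRegion) (edgesThrough-unique x y)) (mk⇔ toImage fromImage))
                       (sym (adjℕ-≢ G₀ u≢u′))

    leavingBase : ∀ {e} → e ∈ filter (¬? ∘ (_⊆? baseRegion)) L → ∃₂ λ i j → CrossEdge i j e × x ∈ₛ e × y ∈ₛ e
    leavingBase e∈ with ∈-filter⁻ (¬? ∘ (_⊆? baseRegion)) e∈
    ... | e∈L , e⊈B with ∈-edgesThrough⁻ e∈L
    ...   | inj₁ (_ , _ , img) , _ , _ = ⊥-elim (e⊈B (baseEdge-⊆ img))
    ...   | inj₂ (inj₁ (_ , _ , _ , _ , img)) , x∈e , _ = ⊥-elim (inCopy⇒¬isBase (copyEdge-inCopy img x∈e) (u , refl))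
    ...   | inj₂ (inj₂ (i , j , cross)) , x∈e , y∈e = i , j , cross , x∈e , y∈e

  adj-base-base-otherPart : ∀ {i i′} q q′ → i ≢ i′ → adjℕ G (base i q) (base i′ q′) ≡ adjℕ G₀ (combine i q) (combine i′ q′)
  adj-base-base-otherPart {i} {i′} q q′ i≢i′ = begin
    adjℕ G x y                                                      ≡⟨ adjℕ-≢ G x≢y ⟩
    length L                                                        ≡⟨ length-partition (_⊆? baseRegion) L ⟩
    length (filter (_⊆? baseRegion) L) + length (filter (¬? ∘ (_⊆? baseRegion)) L)
                                                                    ≡⟨ cong₂ _+_ insideBase (length-noMembers noCross) ⟩
    adjℕ G₀ (combine i q) (combine i′ q′) + 0                       ≡⟨ ℕ.+-identityʳ _ ⟩
    adjℕ G₀ (combine i q) (combine i′ q′)                           ∎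
    where
    open ≡-Reasoning
    open BaseBase {combine i q} {combine i′ q′} (i≢i′ ∘ proj₁ ∘ Fin.combine-injective i q i′ q′)
    noCross : ∀ {e} → e ∈ filter (¬? ∘ (_⊆? baseRegion)) L → ⊥
    noCross e∈ with leavingBase e∈
    ... | _ , _ , (_ , inside , _) , x∈e , y∈e with inside x x∈e | inside y y∈e
    ...   | inj₂ x∈W | _        = inCopy-base x∈W
    ...   | _        | inj₂ y∈W = inCopy-base y∈W
    ...   | inj₁ x∈U | inj₁ y∈U = i≢i′ (trans (inPart-base x∈U) (sym (inPart-base y∈U)))

  distinct⇒2≤ : ∀ {n} {a b : Fin n} → a ≢ b → 2 ≤ n
  distinct⇒2≤ {suc zero}    {zero} {zero} a≢b = contradiction refl a≢b
  distinct⇒2≤ {suc (suc n)} _ = ℕ.s≤s (ℕ.s≤s ℕ.z≤n)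

  coefA≡ : ∀ {p} → 2 ≤ p → p * (coefB k p m ∸ choose (p ∸ 2) (k ∸ 2)) ≡ coefA k p m
  coefA≡ (ℕ.s≤s (ℕ.s≤s _)) = refl

  module SamePart (i : Fin t) {q q′ : Fin p} (q≢q′ : q ≢ q′) where

    open ≡-Reasoning
    open BaseBase {combine i q} {combine i q′} (q≢q′ ∘ proj₂ ∘ Fin.combine-injective i q i q′) public

    Lc : List (Subset N)
    Lc = filter (¬? ∘ (_⊆? baseRegion)) L

    classOf : ∀ {e} → e ∈ Lc → ∃ λ j → e ⊆ crossRegion i j
    classOf e∈ with leavingBase e∈
    ... | _ , j , (_ , inside , _) , x∈e , _ with inside x x∈e
    ...   | inj₂ x∈W = ⊥-elim (inCopy-base x∈W)
    ...   | inj₁ x∈U with inPart-base x∈U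
    ...     | refl = j , ⊆crossRegion inside

    classUnique : ∀ {e j j′} → e ∈ Lc → e ⊆ crossRegion i j → e ⊆ crossRegion i j′ → j ≡ j′
    classUnique {e} e∈ e⊆j e⊆j′ with leavingBase e∈
    ... | _ , j″ , (_ , _ , _ , (_ , z∈e , (w , refl))) , _ = trans (sym (copyIndex e⊆j)) (copyIndex e⊆j′)
      where
      copyIndex : ∀ {j} → e ⊆ crossRegion i j → j″ ≡ j
      copyIndex e⊆ with crossRegion⊆ e⊆ _ z∈e
      ... | inj₁ z∈U = ⊥-elim (inPart-copy z∈U)
      ... | inj₂ z∈W = proj₂ (inCopy-copy z∈W)

    classSize : ∀ j → length (filter (_⊆? crossRegion i j) Lc) ≡ coefB k p m ∸ choose (p ∸ 2) (k ∸ 2)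
    classSize j = begin
      length (filter (_⊆? crossRegion i j) Lc)
        ≡⟨ unique∧set⇒length≡ (Unique.filter⁺ _ (Unique.filter⁺ _ (edgesThrough-unique x y)))
                              (Unique.filter⁺ _ (crossSubsets-unique i j x y)) (mk⇔ toCross fromCross) ⟩
      length (filter (¬? ∘ (_⊆? partRegion i)) (crossSubsets i j x y))
        ≡⟨ length-subsetsThrough-⊈ k x≢y (∈-subsetOf⁺ (inPart? i) (q , refl)) (∈-subsetOf⁺ (inPart? i) (q′ , refl))
                                   (partRegion⊆crossRegion i j) 2≤k ⟩
      choose (∣ crossRegion i j ∣ ∸ 2) (k ∸ 2) ∸ choose (∣ partRegion i ∣ ∸ 2) (k ∸ 2)
        ≡⟨ cong₂ (λ a b → choose (a ∸ 2) (k ∸ 2) ∸ choose (b ∸ 2) (k ∸ 2)) (∣crossRegion∣ i j) (∣partRegion∣ i) ⟩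
      coefB k p m ∸ choose (p ∸ 2) (k ∸ 2) ∎
      where
      toCross : ∀ {e} → e ∈ filter (_⊆? crossRegion i j) Lc → e ∈ filter (¬? ∘ (_⊆? partRegion i)) (crossSubsets i j x y)
      toCross e∈ with ∈-filter⁻ (_⊆? crossRegion i j) e∈
      ... | e∈Lc , e⊆cross with leavingBase e∈Lc
      ...   | _ , _ , (size , _ , _ , (z , z∈e , z∈W)) , x∈e , y∈e =
        ∈-filter⁺ (¬? ∘ (_⊆? partRegion i)) (∈-crossSubsets⁺ x∈e y∈e (crossRegion⊆ e⊆cross) size)
                  (λ e⊆P → inPart×inCopy (∈-subsetOf⁻ (inPart? i) (e⊆P z∈e)) z∈W)
      fromCross : ∀ {e} → e ∈ filter (¬? ∘ (_⊆? partRegion i)) (crossSubsets i j x y) → e ∈ filter (_⊆? crossRegion i j) Lc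
      fromCross e∈ with ∈-filter⁻ (¬? ∘ (_⊆? partRegion i)) e∈
      ... | e∈cross , e⊈P with ∈-crossSubsets⁻ e∈cross | ⊈⇒∃∉ e⊈P
      ...   | x∈e , y∈e , inside , size | z , z∈e , z∉P with inside z z∈e
      ...     | inj₁ z∈U = ⊥-elim (z∉P (∈-subsetOf⁺ (inPart? i) z∈U))
      ...     | inj₂ z∈W = ∈-filter⁺ (_⊆? crossRegion i j)
        (∈-filter⁺ (¬? ∘ (_⊆? baseRegion))
          (∈-edgesThrough⁺ (inj₂ (inj₂ (i , j , size , inside , (x , x∈e , q , refl) , (z , z∈e , z∈W)))) x∈e y∈e)
          (λ e⊆B → inCopy⇒¬isBase z∈W (∈-subsetOf⁻ isBase? (e⊆B z∈e))))
        (⊆crossRegion inside)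

    crossing : length Lc ≡ coefA k p m
    crossing = begin
      length Lc                                                     ≡⟨ length-classes (λ j → _⊆? crossRegion i j) Lc classOf classUnique ⟩
      ℕΣ.sum (λ j → length (filter (_⊆? crossRegion i j) Lc))       ≡⟨ ℕΣ.sum-cong-≋ classSize ⟩
      ℕΣ.sum {p} (λ _ → coefB k p m ∸ choose (p ∸ 2) (k ∸ 2))       ≡⟨ ℕΣ-const p _ ⟩
      p * (coefB k p m ∸ choose (p ∸ 2) (k ∸ 2))                    ≡⟨ coefA≡ (distinct⇒2≤ q≢q′) ⟩
      coefA k p m                                                   ∎

  adj-base-base-samePart : ∀ i {q q′} → q ≢ q′ →
                           adjℕ G (base i q) (base i q′) ≡ coefA k p m + adjℕ G₀ (combine i q) (combine i q′)
  adj-base-base-samePart i {q} {q′} q≢q′ = begin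
    adjℕ G x y                                                      ≡⟨ adjℕ-≢ G x≢y ⟩
    length L                                                        ≡⟨ length-partition (_⊆? baseRegion) L ⟩
    length (filter (_⊆? baseRegion) L) + length Lc                  ≡⟨ cong₂ _+_ insideBase crossing ⟩
    adjℕ G₀ (combine i q) (combine i q′) + coefA k p m              ≡⟨ ℕ.+-comm _ (coefA k p m) ⟩
    coefA k p m + adjℕ G₀ (combine i q) (combine i q′)              ∎
    where
    open ≡-Reasoning
    open SamePart i q≢q′

module CoronaDeterminant {c ℓ} (R : CommutativeRing c ℓ) (k p t m r : ℕ) (2≤k : 2 ≤ k)
  (G₀ : Hypergraph (t ℕ.* p)) (G₀-unique : Unique G₀)
  (Gs : Fin t → Hypergraph m) (Gs-regular : ∀ i → Unique (Gs i) × Regular k r (Gs i))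
  (G : Hypergraph (coronaOrder t p m)) (G-unique : Unique G)
  (G-edges : ∀ e → (e ∈ G → CoronaEdge t p m k G₀ Gs e) × (CoronaEdge t p m k G₀ Gs e → e ∈ G))
  (λ′ : CommutativeRing.Carrier R)
  where

  open import Data.Nat.Base using (zero; suc)
  import Data.Nat.Properties as ℕ
  open import Data.Fin as Fin using (zero; suc; combine; remQuot; splitAt; _↑ˡ_; _↑ʳ_)
  open import Data.Sum using ([_,_]′)
  import Data.Fin.Properties as Fin
  open import Data.Product using (_,_; proj₁; proj₂)
  open import Function.Base using (_∘_)
  open import Relation.Binary.PropositionalEquality as ≡ using (_≡_; _≢_)
  open import Relation.Nullary using (Dec; yes; no; ¬_)
  open CommutativeRing R hiding (zero)
  open import Relation.Binary.Reasoning.Setoid setoid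
  open import Algebra.Properties.Ring ring using (-‿distribˡ-*; -0#≈0#)
  open import Algebra.Properties.AbelianGroup +-abelianGroup using (⁻¹-∙-comm)
  open import Algebra.Solver.Ring.NaturalCoefficients.Default commutativeSemiring using (solve; _:=_; _:+_; _:*_)
  open RingSums R
  open Determinant R
  open HypergraphBasics using (adjℕ-diag; adjℕ-sym; adjℕ-rowSum)
  open Indicator
  open CoronaVertices t p m
  open FinSplit using (combine-elim)
  open CoronaEdges t p m k 2≤k G₀ G₀-unique Gs (proj₁ ∘ Gs-regular) G G-unique G-edges

  a b cc s : Carrier
  a  = fromℕ R (coefA k p m)
  b  = fromℕ R (coefB k p m)
  cc = fromℕ R (coefC k p m)
  s  = fromℕ R (r ℕ.* (k ∸ 1)) + cc * fromℕ R (m ∸ 1)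

  Y : Fin t → Matrix R m
  Y i = _⊞_ R (adjacency R (Gs i)) (_·_ R cc (_⊟_ R (J R m) (I R m)))

  charMatrix : Matrix R N
  charMatrix = _⊟_ R (adjacency R G) (_·_ R λ′ (I R N))

  charMatrixᵢ : Fin t → Matrix R m
  charMatrixᵢ i = _⊟_ R (Y i) (_·_ R λ′ (I R m))

  charMatrix-diag : ∀ x → charMatrix x x ≈ - λ′
  charMatrix-diag x = begin
    fromℕ R (adjℕ G x x) - λ′ * I R N x x  ≈⟨ +-cong (reflexive (≡.cong (fromℕ R) (adjℕ-diag G x))) (-‿cong (*-congˡ (I-diag N x))) ⟩
    0# - λ′ * 1#                           ≈⟨ +-identityˡ _ ⟩
    - (λ′ * 1#)                            ≈⟨ -‿cong (*-identityʳ λ′) ⟩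
    - λ′                                   ∎

  charMatrix-off : ∀ {x z} → x ≢ z → charMatrix x z ≈ fromℕ R (adjℕ G x z)
  charMatrix-off {x} {z} x≢z = begin
    fromℕ R (adjℕ G x z) - λ′ * I R N x z  ≈⟨ +-congˡ (-‿cong (*-congˡ (I-off N x≢z))) ⟩
    fromℕ R (adjℕ G x z) - λ′ * 0#         ≈⟨ +-congˡ (trans (-‿cong (zeroʳ λ′)) -0#≈0#) ⟩
    fromℕ R (adjℕ G x z) + 0#              ≈⟨ +-identityʳ _ ⟩
    fromℕ R (adjℕ G x z)                   ∎

  charMatrixᵢ-diag : ∀ i w → charMatrixᵢ i w w ≈ - λ′
  charMatrixᵢ-diag i w = begin
    (fromℕ R (adjℕ (Gs i) w w) + cc * (1# - I R m w w)) - λ′ * I R m w w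
      ≈⟨ +-cong (+-cong (reflexive (≡.cong (fromℕ R) (adjℕ-diag (Gs i) w))) (*-congˡ (+-congˡ (-‿cong (I-diag m w)))))
                (-‿cong (trans (*-congˡ (I-diag m w)) (*-identityʳ λ′))) ⟩
    (0# + cc * (1# - 1#)) - λ′
      ≈⟨ +-congʳ (trans (+-identityˡ _) (trans (*-congˡ (-‿inverseʳ 1#)) (zeroʳ cc))) ⟩
    0# - λ′
      ≈⟨ +-identityˡ _ ⟩
    - λ′ ∎

  charMatrixᵢ-off : ∀ i {w w′} → w ≢ w′ → charMatrixᵢ i w w′ ≈ fromℕ R (adjℕ (Gs i) w w′) + cc
  charMatrixᵢ-off i {w} {w′} w≢w′ = begin
    (fromℕ R (adjℕ (Gs i) w w′) + cc * (1# - I R m w w′)) - λ′ * I R m w w′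
      ≈⟨ +-cong (+-congˡ (*-congˡ (+-congˡ (-‿cong (I-off m w≢w′))))) (-‿cong (*-congˡ (I-off m w≢w′))) ⟩
    (fromℕ R (adjℕ (Gs i) w w′) + cc * (1# - 0#)) - λ′ * 0#
      ≈⟨ +-cong (+-congˡ (trans (*-congˡ (trans (+-congˡ -0#≈0#) (+-identityʳ 1#))) (*-identityʳ cc)))
                (trans (-‿cong (zeroʳ λ′)) -0#≈0#) ⟩
    (fromℕ R (adjℕ (Gs i) w w′) + cc) + 0#
      ≈⟨ +-identityʳ _ ⟩
    fromℕ R (adjℕ (Gs i) w w′) + cc ∎

  charMatrix-copy-copy : ∀ i j w w′ → charMatrix (copy i j w) (copy i j w′) ≈ charMatrixᵢ i w w′
  charMatrix-copy-copy i j w w′ = byCases (w Fin.≟ w′)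
    where
    byCases : Dec (w ≡ w′) → charMatrix (copy i j w) (copy i j w′) ≈ charMatrixᵢ i w w′
    byCases (yes ≡.refl) = trans (charMatrix-diag (copy i j w)) (sym (charMatrixᵢ-diag i w))
    byCases (no  w≢w′)   = begin
      charMatrix (copy i j w) (copy i j w′)        ≈⟨ charMatrix-off (w≢w′ ∘ proj₂ ∘ proj₂ ∘ copy-injective) ⟩
      fromℕ R (adjℕ G (copy i j w) (copy i j w′))  ≡⟨ ≡.cong (fromℕ R) (adj-copy-copy i j w≢w′) ⟩
      fromℕ R (coefC k p m ℕ.+ adjℕ (Gs i) w w′)   ≈⟨ trans (fromℕ-+ (coefC k p m) (adjℕ (Gs i) w w′)) (+-comm cc _) ⟩
      fromℕ R (adjℕ (Gs i) w w′) + cc              ≈⟨ charMatrixᵢ-off i w≢w′ ⟨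
      charMatrixᵢ i w w′                           ∎

  charMatrix-copy-copy-otherCopy : ∀ {i j i′ j′} w w′ → ¬ (i ≡ i′ × j ≡ j′) → charMatrix (copy i j w) (copy i′ j′ w′) ≈ 0#
  charMatrix-copy-copy-otherCopy w w′ ij≢i′j′ =
    trans (charMatrix-off (λ eq → ij≢i′j′ (proj₁ (copy-injective eq) , proj₁ (proj₂ (copy-injective eq)))))
          (reflexive (≡.cong (fromℕ R) (adj-copy-copy-otherCopy w w′ ij≢i′j′)))

  charMatrix-base-copy : ∀ i q j w → charMatrix (base i q) (copy i j w) ≈ b
  charMatrix-base-copy i q j w = trans (charMatrix-off base≢copy) (reflexive (≡.cong (fromℕ R) (adj-base-copy i q j w)))

  charMatrix-copy-base : ∀ i q j w → charMatrix (copy i j w) (base i q) ≈ b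
  charMatrix-copy-base i q j w = trans (charMatrix-off (base≢copy ∘ ≡.sym))
    (reflexive (≡.cong (fromℕ R) (≡.trans (adjℕ-sym G (copy i j w) (base i q)) (adj-base-copy i q j w))))

  charMatrix-base-copy-otherPart : ∀ {i i′} q j w → i ≢ i′ → charMatrix (base i q) (copy i′ j w) ≈ 0#
  charMatrix-base-copy-otherPart q j w i≢i′ =
    trans (charMatrix-off base≢copy) (reflexive (≡.cong (fromℕ R) (adj-base-copy-otherPart q j w i≢i′)))

  charMatrix-copy-base-otherPart : ∀ {i i′} q j w → i ≢ i′ → charMatrix (copy i′ j w) (base i q) ≈ 0#
  charMatrix-copy-base-otherPart q j w i≢i′ = trans (charMatrix-off (base≢copy ∘ ≡.sym))
    (reflexive (≡.cong (fromℕ R) (≡.trans (adjℕ-sym G (copy _ j w) (base _ q)) (adj-base-copy-otherPart q j w i≢i′))))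

  charMatrixᵢ-expand : ∀ i w w′ → charMatrixᵢ i w w′ ≈ fromℕ R (adjℕ (Gs i) w w′) + (cc + (- (cc + λ′)) * I R m w w′)
  charMatrixᵢ-expand i w w′ = byCases (w Fin.≟ w′)
    where
    byCases : Dec (w ≡ w′) → charMatrixᵢ i w w′ ≈ fromℕ R (adjℕ (Gs i) w w′) + (cc + (- (cc + λ′)) * I R m w w′)
    byCases (yes ≡.refl) = begin
      charMatrixᵢ i w w                                        ≈⟨ charMatrixᵢ-diag i w ⟩
      - λ′                                                     ≈⟨ x+-[x+y]≈-y cc λ′ ⟨
      cc + - (cc + λ′)                                         ≈⟨ +-identityˡ _ ⟨
      0# + (cc + - (cc + λ′))                                  ≈⟨ +-cong (reflexive (≡.cong (fromℕ R) (adjℕ-diag (Gs i) w)))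
                                                                         (+-congˡ (trans (*-congˡ (I-diag m w)) (*-identityʳ _))) ⟨
      fromℕ R (adjℕ (Gs i) w w) + (cc + (- (cc + λ′)) * I R m w w) ∎
    byCases (no  w≢w′)   = begin
      charMatrixᵢ i w w′                                       ≈⟨ charMatrixᵢ-off i w≢w′ ⟩
      fromℕ R (adjℕ (Gs i) w w′) + cc                          ≈⟨ +-congˡ (+-identityʳ cc) ⟨
      fromℕ R (adjℕ (Gs i) w w′) + (cc + 0#)                   ≈⟨ +-congˡ (+-congˡ (trans (*-congˡ (I-off m w≢w′)) (zeroʳ _))) ⟨
      fromℕ R (adjℕ (Gs i) w w′) + (cc + (- (cc + λ′)) * I R m w w′) ∎

  copyRowSum : ∀ i j w → Σ.sum (λ w′ → charMatrix (copy i j w) (copy i j w′)) ≈ s - λ′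
  copyRowSum i j w = begin
    Σ.sum (λ w′ → charMatrix (copy i j w) (copy i j w′))
      ≈⟨ Σ.sum-cong-≋ (λ w′ → trans (charMatrix-copy-copy i j w w′) (charMatrixᵢ-expand i w w′)) ⟩
    Σ.sum (λ w′ → A w′ + (cc + (- (cc + λ′)) * I R m w w′))
      ≈⟨ trans (Σ.∑-distrib-+ A _) (+-congˡ (Σ.∑-distrib-+ (λ _ → cc) (λ w′ → (- (cc + λ′)) * I R m w w′))) ⟩
    Σ.sum A + (Σ.sum {m} (λ _ → cc) + Σ.sum (λ w′ → (- (cc + λ′)) * I R m w w′))
      ≈⟨ +-cong (sym (fromℕ-∑ (adjℕ (Gs i) w))) (+-cong (∑-const m cc) (sym (*-distribˡ-sum (- (cc + λ′)) (I R m w)))) ⟩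
    fromℕ R (ℕΣ.sum (adjℕ (Gs i) w)) + (fromℕ R m * cc + (- (cc + λ′)) * Σ.sum (I R m w))
      ≈⟨ +-cong (reflexive (≡.cong (fromℕ R) rowSum))
                (+-cong (trans (*-congʳ (fromℕ-pred m w)) (trans (distribʳ cc 1# _) (+-congʳ (*-identityˡ cc))))
                        (trans (*-congˡ (trans (Σ.sum-single w (λ w′ w′≢w → I-off m (w′≢w ∘ ≡.sym))) (I-diag m w))) (*-identityʳ _))) ⟩
    fromℕ R (r ℕ.* (k ∸ 1)) + ((cc + fromℕ R (m ∸ 1) * cc) + - (cc + λ′))
      ≈⟨ +-congˡ (trans (+-congʳ (+-comm cc _)) (trans (+-assoc _ cc _) (+-congˡ (x+-[x+y]≈-y cc λ′)))) ⟩
    fromℕ R (r ℕ.* (k ∸ 1)) + (fromℕ R (m ∸ 1) * cc + - λ′)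
      ≈⟨ solve 4 (λ d c M l → (d :+ (M :* c :+ l)) := ((d :+ c :* M) :+ l)) refl _ cc _ (- λ′) ⟩
    s - λ′ ∎
    where
    A : Fin m → Carrier
    A w′ = fromℕ R (adjℕ (Gs i) w w′)
    rowSum : ℕΣ.sum (adjℕ (Gs i) w) ≡ r ℕ.* (k ∸ 1)
    rowSum = ≡.trans (adjℕ-rowSum k (Gs i) (proj₁ (proj₂ (Gs-regular i))) w)
                     (≡.cong (ℕ._* (k ∸ 1)) (proj₂ (proj₂ (Gs-regular i)) w))

  n : ℕ
  n = t ℕ.* p

  partOfBase : Fin n → Fin t
  partOfBase u = proj₁ (remQuot {t} p u)

  partOfCopy : Fin (n ℕ.* m) → Fin t
  partOfCopy v = partOfBase (proj₁ (remQuot {n} m v))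

  module ColumnOperations (y : Carrier) where

    -- - b y is chosen so that b + (- b y) (s - λ′) = 0, which clears the copy rows in the base columns.
    coefficient : Fin n → Fin (n ℕ.* m) → Carrier
    coefficient u v = - (b * y) * fromℕ R (indicator (partOfBase u Fin.≟ partOfCopy v))

    coefficient-eval : ∀ i q i′ j w → coefficient (combine i q) (combine (combine i′ j) w)
                                        ≡ - (b * y) * fromℕ R (indicator (i Fin.≟ i′))
    coefficient-eval i q i′ j w = ≡.cong₂ (λ x z → - (b * y) * fromℕ R (indicator (x Fin.≟ z)))
      (≡.cong proj₁ (Fin.remQuot-combine i q))
      (≡.trans (≡.cong (partOfBase ∘ proj₁) (Fin.remQuot-combine (combine i′ j) w)) (≡.cong proj₁ (Fin.remQuot-combine i′ j)))

    added : Fin n → Fin N → Carrier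
    added u x = Σ.sum (λ v → coefficient u v * charMatrix x (n ↑ʳ v))

    added-eval : ∀ i q x → added (combine i q) x ≈ - (b * y) * Σ.sum (λ j → Σ.sum (λ w → charMatrix x (copy i j w)))
    added-eval i q x = begin
      added (combine i q) x
        ≈⟨ trans (Σ.sum-combine n _) (Σ.sum-combine t _) ⟩
      Σ.sum (λ i′ → Σ.sum (λ j → Σ.sum (λ w → coefficient (combine i q) (combine (combine i′ j) w) * charMatrix x (copy i′ j w))))
        ≈⟨ Σ.sum-single i (λ i′ i′≢i → Σ.sum-zero {p} (λ j → Σ.sum-zero {m} (λ w → otherPart≈0 i′≢i j w))) ⟩
      Σ.sum (λ j → Σ.sum (λ w → coefficient (combine i q) (combine (combine i j) w) * charMatrix x (copy i j w)))
        ≈⟨ Σ.sum-cong-≋ (λ j → Σ.sum-cong-≋ (λ w → *-congʳ (samePart j w))) ⟩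
      Σ.sum (λ j → Σ.sum (λ w → - (b * y) * charMatrix x (copy i j w)))
        ≈⟨ trans (Σ.sum-cong-≋ (λ j → sym (*-distribˡ-sum (- (b * y)) (λ w → charMatrix x (copy i j w)))))
                 (sym (*-distribˡ-sum (- (b * y)) (λ j → Σ.sum (λ w → charMatrix x (copy i j w))))) ⟩
      - (b * y) * Σ.sum (λ j → Σ.sum (λ w → charMatrix x (copy i j w))) ∎
      where
      samePart : ∀ j w → coefficient (combine i q) (combine (combine i j) w) ≈ - (b * y)
      samePart j w = trans (reflexive (coefficient-eval i q i j w))
                           (trans (*-congˡ (trans (reflexive (≡.cong (fromℕ R) (indicator-yes (i Fin.≟ i) ≡.refl))) (+-identityʳ 1#)))
                                  (*-identityʳ _))
      otherPart≈0 : ∀ {i′} → i′ ≢ i → ∀ j w → coefficient (combine i q) (combine (combine i′ j) w) * charMatrix x (copy i′ j w) ≈ 0#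
      otherPart≈0 i′≢i j w = trans (*-congʳ (trans (reflexive (coefficient-eval i q _ j w))
                                     (trans (*-congˡ (reflexive (≡.cong (fromℕ R) (indicator-no (i Fin.≟ _) (i′≢i ∘ ≡.sym))))) (zeroʳ _))))
                                   (zeroˡ _)

    L : Matrix R N
    L x z = [ (λ u → charMatrix x z + added u x) , (λ _ → charMatrix x z) ]′ (splitAt n z)

    L-left : ∀ x u → L x (u ↑ˡ n ℕ.* m) ≡ charMatrix x (u ↑ˡ n ℕ.* m) + added u x
    L-left x u rewrite Fin.splitAt-↑ˡ n u (n ℕ.* m) = ≡.refl

    L-right : ∀ x v → L x (n ↑ʳ v) ≡ charMatrix x (n ↑ʳ v)
    L-right x v rewrite Fin.splitAt-↑ʳ n (n ℕ.* m) v = ≡.refl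

    det-L : det R L ≈ det R charMatrix
    det-L = det-addRightColumnsToLeft n charMatrix coefficient L (λ x u → reflexive (L-left x u)) (λ x v → reflexive (L-right x v))

    L-base-base : ∀ i q i′ q′ →
      L (base i q) (base i′ q′) ≈ charMatrix (base i q) (base i′ q′) + - (b * y) * Σ.sum (λ j → Σ.sum (λ w → charMatrix (base i q) (copy i′ j w)))
    L-base-base i q i′ q′ = trans (reflexive (L-left (base i q) (combine i′ q′))) (+-congˡ (added-eval i′ q′ (base i q)))

    L-copy-base : ∀ i j w i′ q′ →
      L (copy i j w) (base i′ q′)
        ≈ charMatrix (copy i j w) (base i′ q′) + - (b * y) * Σ.sum (λ j′ → Σ.sum (λ w′ → charMatrix (copy i j w) (copy i′ j′ w′)))
    L-copy-base i j w i′ q′ = trans (reflexive (L-left (copy i j w) (combine i′ q′))) (+-congˡ (added-eval i′ q′ (copy i j w)))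

    Q c₀ : Carrier
    Q  = b * b * fromℕ R p * fromℕ R m * y
    c₀ = a - Q

    K : Matrix R p
    K = _⊟_ R (_·_ R c₀ (J R p)) (_·_ R (a + λ′) (I R p))

    schurComplement : Matrix R n
    schurComplement = _⊞_ R (adjacency R G₀) (_⊗_ R (I R t) K)

    K-diag : ∀ q → K q q ≈ c₀ - (a + λ′)
    K-diag q = +-cong (*-identityʳ c₀) (-‿cong (trans (*-congˡ (I-diag p q)) (*-identityʳ _)))

    K-off : ∀ {q q′} → q ≢ q′ → K q q′ ≈ c₀
    K-off q≢q′ = trans (+-cong (*-identityʳ c₀) (trans (-‿cong (trans (*-congˡ (I-off p q≢q′)) (zeroʳ _))) -0#≈0#)) (+-identityʳ c₀)

    -by·pmb≈-Q : - (b * y) * (fromℕ R p * (fromℕ R m * b)) ≈ - Q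
    -by·pmb≈-Q = trans (sym (-‿distribˡ-* _ _))
      (-‿cong (solve 4 (λ B Y P M → ((B :* Y) :* (P :* (M :* B))) := (B :* B :* P :* M :* Y)) refl b y (fromℕ R p) (fromℕ R m)))

    -λ′-Q≈c₀-[a+λ′] : - λ′ + - Q ≈ c₀ - (a + λ′)
    -λ′-Q≈c₀-[a+λ′] = sym (begin
      (a + - Q) + - (a + λ′)     ≈⟨ +-congˡ (⁻¹-∙-comm a λ′) ⟨
      (a + - Q) + (- a + - λ′)   ≈⟨ solve 4 (λ A nQ nA nL → ((A :+ nQ) :+ (nA :+ nL)) := ((A :+ nA) :+ (nL :+ nQ))) refl a (- Q) (- a) (- λ′) ⟩
      (a + - a) + (- λ′ + - Q)   ≈⟨ trans (+-congʳ (-‿inverseʳ a)) (+-identityˡ _) ⟩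
      - λ′ + - Q                 ∎)

    L-base-base-samePart : ∀ i q q′ → L (base i q) (base i q′) ≈ charMatrix (base i q) (base i q′) + - Q
    L-base-base-samePart i q q′ = trans (L-base-base i q i q′) (+-congˡ (trans (*-congˡ copies) -by·pmb≈-Q))
      where
      copies : Σ.sum (λ j → Σ.sum (λ w → charMatrix (base i q) (copy i j w))) ≈ fromℕ R p * (fromℕ R m * b)
      copies = trans (Σ.sum-cong-≋ (λ j → trans (Σ.sum-cong-≋ (λ w → charMatrix-base-copy i q j w)) (∑-const m b))) (∑-const p _)

    L-base-base-otherPart : ∀ {i i′} q q′ → i ≢ i′ → L (base i q) (base i′ q′) ≈ fromℕ R (adjℕ G₀ (combine i q) (combine i′ q′))
    L-base-base-otherPart {i} {i′} q q′ i≢i′ = begin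
      L (base i q) (base i′ q′)
        ≈⟨ L-base-base i q i′ q′ ⟩
      charMatrix (base i q) (base i′ q′) + - (b * y) * Σ.sum (λ j → Σ.sum (λ w → charMatrix (base i q) (copy i′ j w)))
        ≈⟨ +-cong (charMatrix-off (i≢i′ ∘ proj₁ ∘ base-injective))
                  (*-congˡ (Σ.sum-zero {p} (λ j → Σ.sum-zero {m} (λ w → charMatrix-base-copy-otherPart q j w i≢i′)))) ⟩
      fromℕ R (adjℕ G (base i q) (base i′ q′)) + - (b * y) * 0#
        ≈⟨ +-cong (reflexive (≡.cong (fromℕ R) (adj-base-base-otherPart q q′ i≢i′))) (zeroʳ _) ⟩
      fromℕ R (adjℕ G₀ (combine i q) (combine i′ q′)) + 0#
        ≈⟨ +-identityʳ _ ⟩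
      fromℕ R (adjℕ G₀ (combine i q) (combine i′ q′)) ∎

    upperLeft≈schurComplement : ∀ i q i′ q′ → L (base i q) (base i′ q′) ≈ schurComplement (combine i q) (combine i′ q′)
    upperLeft≈schurComplement i q i′ q′ = trans (byCases (i Fin.≟ i′) (q Fin.≟ q′)) (sym (+-congˡ (reflexive (⊗-combine (I R t) K i q i′ q′))))
      where
      d : Carrier
      d = fromℕ R (adjℕ G₀ (combine i q) (combine i′ q′))
      byCases : Dec (i ≡ i′) → Dec (q ≡ q′) → L (base i q) (base i′ q′) ≈ d + I R t i i′ * K q q′
      byCases (no i≢i′) _ = begin
        L (base i q) (base i′ q′)  ≈⟨ L-base-base-otherPart q q′ i≢i′ ⟩
        d                          ≈⟨ +-identityʳ d ⟨
        d + 0#                     ≈⟨ +-congˡ (trans (*-congʳ (I-off t i≢i′)) (zeroˡ _)) ⟨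
        d + I R t i i′ * K q q′    ∎
      byCases (yes ≡.refl) (yes ≡.refl) = begin
        L (base i q) (base i q)                 ≈⟨ L-base-base-samePart i q q ⟩
        charMatrix (base i q) (base i q) + - Q  ≈⟨ +-congʳ (charMatrix-diag (base i q)) ⟩
        - λ′ + - Q                              ≈⟨ -λ′-Q≈c₀-[a+λ′] ⟩
        c₀ - (a + λ′)                           ≈⟨ trans (+-identityˡ _) (trans (*-congʳ (I-diag t i)) (*-identityˡ _)) ⟨
        0# + I R t i i * (c₀ - (a + λ′))        ≈⟨ +-cong (reflexive (≡.cong (fromℕ R) (adjℕ-diag G₀ (combine i q)))) (*-congˡ (K-diag q)) ⟨
        d + I R t i i * K q q                   ∎
      byCases (yes ≡.refl) (no q≢q′) = begin
        L (base i q) (base i q′)                 ≈⟨ L-base-base-samePart i q q′ ⟩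
        charMatrix (base i q) (base i q′) + - Q  ≈⟨ +-congʳ (charMatrix-off (q≢q′ ∘ proj₂ ∘ base-injective)) ⟩
        fromℕ R (adjℕ G (base i q) (base i q′)) + - Q
          ≈⟨ +-congʳ (trans (reflexive (≡.cong (fromℕ R) (adj-base-base-samePart i q≢q′))) (fromℕ-+ (coefA k p m) _)) ⟩
        (a + d) + - Q                            ≈⟨ solve 3 (λ A D nQ → ((A :+ D) :+ nQ) := (D :+ (A :+ nQ))) refl a d (- Q) ⟩
        d + c₀                                   ≈⟨ +-congˡ (trans (*-congʳ (I-diag t i)) (trans (*-identityˡ _) (K-off q≢q′))) ⟨
        d + I R t i i * K q q′                   ∎

    module _ (y-inverse : (s - λ′) * y ≈ 1#) where

      copy-base≈0 : ∀ i j w i′ q′ → L (copy i j w) (base i′ q′) ≈ 0#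
      copy-base≈0 i j w i′ q′ = trans (L-copy-base i j w i′ q′) (byParts (i′ Fin.≟ i))
        where
        byParts : Dec (i′ ≡ i) →
          charMatrix (copy i j w) (base i′ q′) + - (b * y) * Σ.sum (λ j′ → Σ.sum (λ w′ → charMatrix (copy i j w) (copy i′ j′ w′))) ≈ 0#
        byParts (no i′≢i) = begin
          charMatrix (copy i j w) (base i′ q′) + - (b * y) * Σ.sum (λ j′ → Σ.sum (λ w′ → charMatrix (copy i j w) (copy i′ j′ w′)))
            ≈⟨ +-cong (charMatrix-copy-base-otherPart q′ j w i′≢i)
                      (*-congˡ (Σ.sum-zero {p} (λ j′ → Σ.sum-zero {m} (λ w′ → charMatrix-copy-copy-otherCopy w w′ (i′≢i ∘ ≡.sym ∘ proj₁))))) ⟩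
          0# + - (b * y) * 0#
            ≈⟨ trans (+-identityˡ _) (zeroʳ _) ⟩
          0# ∎
        byParts (yes ≡.refl) = begin
          charMatrix (copy i j w) (base i q′) + - (b * y) * Σ.sum (λ j′ → Σ.sum (λ w′ → charMatrix (copy i j w) (copy i j′ w′)))
            ≈⟨ +-cong (charMatrix-copy-base i q′ j w)
                      (*-congˡ (trans (Σ.sum-single j (λ j′ j′≢j → Σ.sum-zero {m} (λ w′ → charMatrix-copy-copy-otherCopy w w′ (j′≢j ∘ ≡.sym ∘ proj₂))))
                                      (copyRowSum i j w))) ⟩
          b + - (b * y) * (s - λ′)
            ≈⟨ +-congˡ (trans (sym (-‿distribˡ-* _ _)) (-‿cong (trans (*-assoc b y _) (trans (*-congˡ (trans (*-comm y _) y-inverse)) (*-identityʳ b))))) ⟩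
          b + - b
            ≈⟨ -‿inverseʳ b ⟩
          0# ∎

      lowerLeft≈0 : ∀ v u → L (n ↑ʳ v) (u ↑ˡ n ℕ.* m) ≈ 0#
      lowerLeft≈0 v u = combine-elim {n = n} {m} {P = λ v → L (n ↑ʳ v) (u ↑ˡ n ℕ.* m) ≈ 0#}
        (λ g w → combine-elim {n = t} {p} {P = λ g → L (n ↑ʳ combine g w) (u ↑ˡ n ℕ.* m) ≈ 0#}
          (λ i j → combine-elim {n = t} {p} {P = λ u → L (copy i j w) (u ↑ˡ n ℕ.* m) ≈ 0#} (copy-base≈0 i j w) u) g) v

    upperLeft : Matrix R n
    upperLeft u u′ = L (u ↑ˡ n ℕ.* m) (u′ ↑ˡ n ℕ.* m)

    lowerRight : Matrix R (n ℕ.* m)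
    lowerRight v v′ = L (n ↑ʳ v) (n ↑ʳ v′)

    det-upperLeft : det R upperLeft ≈ det R schurComplement
    det-upperLeft = det-cong (λ u u′ → combine-elim {n = t} {p} {P = λ u → upperLeft u u′ ≈ schurComplement u u′}
                               (λ i q → combine-elim {n = t} {p} {P = λ u′ → upperLeft (combine i q) u′ ≈ schurComplement (combine i q) u′} (upperLeft≈schurComplement i q) u′) u)

    det-lowerRight : det R lowerRight ≈ pow R (prodFin R (λ i → det R (charMatrixᵢ i))) p
    det-lowerRight = begin
      det R lowerRight
        ≈⟨ det-blockDiagonal n lowerRight (charMatrixᵢ ∘ partOfBase) offDiagonal diagonal ⟩
      Π.sum (λ g → det R (charMatrixᵢ (partOfBase g)))
        ≈⟨ Π.sum-combine t {p} _ ⟩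
      Π.sum {t} (λ i → Π.sum {p} (λ j → det R (charMatrixᵢ (partOfBase (combine i j)))))
        ≡⟨ Π.sum-cong-≗ {t} (λ i → Π.sum-cong-≗ {p} (λ j → ≡.cong (det R ∘ charMatrixᵢ ∘ proj₁) (Fin.remQuot-combine {t} {p} i j))) ⟩
      Π.sum {t} (λ i → Π.sum {p} (λ _ → det R (charMatrixᵢ i)))
        ≈⟨ Π.∑-comm {t} {p} (λ i _ → det R (charMatrixᵢ i)) ⟩
      Π.sum {p} (λ _ → Π.sum (λ i → det R (charMatrixᵢ i)))
        ≡⟨ ∏-const p _ ⟩
      pow R (Π.sum (λ i → det R (charMatrixᵢ i))) p
        ≡⟨ ≡.cong (λ x → pow R x p) (prodFin≡∏ (λ i → det R (charMatrixᵢ i))) ⟨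
      pow R (prodFin R (λ i → det R (charMatrixᵢ i))) p ∎
      where
      offDiagonal : ∀ (g g′ : Fin n) (w w′ : Fin m) → g ≢ g′ → lowerRight (combine g w) (combine g′ w′) ≈ 0#
      offDiagonal g g′ w w′ = combine-elim {n = t} {p} {P = λ g → g ≢ g′ → lowerRight (combine g w) (combine g′ w′) ≈ 0#}
        (λ i j → combine-elim {n = t} {p} {P = λ g′ → combine i j ≢ g′ → lowerRight (combine (combine i j) w) (combine g′ w′) ≈ 0#}
          (λ i′ j′ ij≢i′j′ → trans (reflexive (L-right (copy i j w) (combine (combine i′ j′) w′)))
             (charMatrix-copy-copy-otherCopy w w′ (λ (i≡i′ , j≡j′) → ij≢i′j′ (≡.cong₂ combine i≡i′ j≡j′)))) g′) g
      diagonal : ∀ (g : Fin n) (w w′ : Fin m) → lowerRight (combine g w) (combine g w′) ≈ charMatrixᵢ (partOfBase g) w w′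
      diagonal g w w′ = combine-elim {n = t} {p} {P = λ g → lowerRight (combine g w) (combine g w′) ≈ charMatrixᵢ (partOfBase g) w w′}
        (λ i j → trans (reflexive (L-right (copy i j w) (combine (combine i j) w′))) (trans (charMatrix-copy-copy i j w w′)
                  (reflexive (≡.cong (λ i′ → charMatrixᵢ i′ w w′) (≡.sym (≡.cong proj₁ (Fin.remQuot-combine i j))))))) g

    det-charMatrix : (s - λ′) * y ≈ 1# → det R charMatrix ≈ pow R (prodFin R (λ i → det R (charMatrixᵢ i))) p * det R schurComplement
    det-charMatrix y-inverse = begin
      det R charMatrix                 ≈⟨ det-L ⟨
      det R L                          ≈⟨ det-blockTriangular n L (lowerLeft≈0 y-inverse) ⟩
      det R upperLeft * det R lowerRight ≈⟨ *-cong det-upperLeft det-lowerRight ⟩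
      det R schurComplement * pow R (prodFin R (λ i → det R (charMatrixᵢ i))) p ≈⟨ *-comm _ _ ⟩
      pow R (prodFin R (λ i → det R (charMatrixᵢ i))) p * det R schurComplement ∎

theorem3p1 : ∀ {c ℓ} (F : Field c ℓ) (k p t m r : ℕ) → 2 ≤ k →
    (G₀ : Hypergraph (t ℕ.* p)) → Unique G₀ → Uniform k G₀ →
    (Gs : Fin t → Hypergraph m) → (∀ i → Unique (Gs i) × Regular k r (Gs i)) →
    (G : Hypergraph (coronaOrder t p m)) → Unique G →
    (∀ e → (e ∈ G → CoronaEdge t p m k G₀ Gs e) × (CoronaEdge t p m k G₀ Gs e → e ∈ G)) →
    let open Field F
        R = commutativeRing
        a = fromℕ R (coefA k p m)
        b = fromℕ R (coefB k p m)
        cc = fromℕ R (coefC k p m)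
        s = fromℕ R (r ℕ.* (k ∸ 1)) + cc * fromℕ R (m ∸ 1)
        Y = λ (i : Fin t) → _⊞_ R (adjacency R (Gs i)) (_·_ R cc (_⊟_ R (J R m) (I R m)))
    in ∀ (λ' : Carrier) → ¬ (λ' ≈ s) → ∀ (y : Carrier) → (s - λ') * y ≈ 1# →
       charPoly R (adjacency R G) λ'
         ≈ pow R (prodFin R (λ i → charPoly R (Y i) λ')) p
           * det R (_⊞_ R (adjacency R G₀)
                          (_⊗_ R (I R t)
                             (_⊟_ R (_·_ R (a - b * b * fromℕ R p * fromℕ R m * y) (J R p))
                                    (_·_ R (a + λ') (I R p)))))
theorem3p1 F k p t m r 2≤k G₀ G₀-unique _ Gs Gs-regular G G-unique G-edges λ′ _ y y-inverse =
  ColumnOperations.det-charMatrix y y-inverse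
  where open CoronaDeterminant (Field.commutativeRing F) k p t m r 2≤k G₀ G₀-unique Gs Gs-regular G G-unique G-edges λ′
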